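{- The relations $\sim_{\mathrm{baxt}}$ and $\equiv_{\mathrm{baxt}}$ on $\mathcal{A}^*$ coincide.
   Context: $\mathcal{A} = \{1,2,3,\ldots\}$ with the usual order; $\mathcal{A}^*$ the free monoid over $\mathcal{A}$. Standardization $\mathrm{std}(u)$ of a word of length $k$: replace occurrences of $1$ from left to right by $1,2,\ldots$, then occurrences of $2$ from left to right by the next integers, etc.; view it as a permutation in one-line notation, with inverse $\mathrm{std}(u)^{ -1}$. For a word $w$ without repeated letters, $\mathrm{dectree}(w)$ (resp. $\mathrm{inctree}(w)$) is empty if $w=\varepsilon$ and otherwise, writing $w = sms'$ with $m$ the maximum (resp. minimum) letter, has root $m$ with left and right subtrees the corresponding trees of $s$ and $s'$. Let $\sigma_{\mathrm{baxt}}(u) = (\mathrm{Sh}(\mathrm{inctree}(\mathrm{std}(u)^{ -1})),\mathrm{Sh}(\mathrm{dectree}(\mathrm{std}(u)^{ -1})))$, where $\mathrm{Sh}$ is the underlying unlabelled binary tree. Quasi-Kashiwara operators $\ddot e_i,\ddot f_i$ ($i\in\mathbb{N}$): if $u$ contains a letter $i+1$ to the left of a letter $i$, both undefined; otherwise $\ddot e_i(u)$ replaces the leftmost $i+1$ by $i$ (undefined if none) and $\ddot f_i(u)$ replaces the rightmost $i$ by $i+1$ (undefined if none). $\Gamma(\mathrm{hypo})$ is the directed graph on $\mathcal{A}^*$ with edges $u \to \ddot f_i(u)$ labelled $i$; $\Gamma(\mathrm{hypo},u)$ is the connected component of $u$. Define $u \sim_{\mathrm{baxt}} v$ iff there is a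 labelled directed graph isomorphism $\theta : \Gamma(\mathrm{hypo},u) \to \Gamma(\mathrm{hypo},v)$ with $\theta(u) = v$ and $\sigma_{\mathrm{baxt}}(\theta(w)) = \sigma_{\mathrm{baxt}}(w)$ for all $w \in \Gamma(\mathrm{hypo},u)$. Right strict binary search tree: each node's label is $\ge$ all labels in its left subtree and $<$ all in its right subtree; $\mathrm{rtree}(a_1\cdots a_k)$ is built by inserting $a_k,\ldots,a_1$ into the empty tree, insertion of $a$ going left if $a \le$ root label, right otherwise, creating a node at an empty position. Left strict binary search tree: each node's label is $>$ all labels in its left subtree and $\le$ all in its right subtree; $\mathrm{ltree}(a_1\cdots a_k)$ is built by inserting $a_1,\ldots,a_k$, insertion of $a$ going right if $a \ge$ root label, left otherwise. $u \equiv_{\mathrm{baxt}} v$ iff $\mathrm{ltree}(u)=\mathrm{ltree}(v)$ and $\mathrm{rtree}(u)=\mathrm{rtree}(v)$. -}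

module Defs where

open import Data.Nat using (ℕ; zero; suc; _+_; _⊓_; _⊔_; _≡ᵇ_; _<ᵇ_; _≤ᵇ_)
open import Data.Bool using (Bool; true; false; if_then_else_; _∨_)
open import Data.List using (List; []; _∷_; length; reverse; map; foldr; foldl; take; zip; upTo; applyUpTo)
open import Data.Maybe using (Maybe; just; nothing) renaming (map to mmap)
open import Data.Product using (Σ; ∃; _×_; _,_)
open import Data.Sum using (_⊎_)
open import Relation.Binary.PropositionalEquality using (_≡_)
open import Relation.Binary.Construct.Closure.ReflexiveTransitive using (Star)
open import Function.Bundles using (_⇔_)

-- Convention: the alphabet 𝒜 = {1,2,3,...} is represented by ℕ, the
-- natural number a standing for the letter a+1 (an order isomorphism).
-- Accordingly the operator index i : ℕ acts on the letters i and i+1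
-- (representing the paper's i+1, i+2).
Word : Set
Word = List ℕ

countLt : ℕ → List ℕ → ℕ
countLt a [] = 0
countLt a (x ∷ xs) = (if x <ᵇ a then 1 else 0) + countLt a xs

countEq : ℕ → List ℕ → ℕ
countEq a [] = 0
countEq a (x ∷ xs) = (if x ≡ᵇ a then 1 else 0) + countEq a xs

-- value at position p (0-based) carrying letter a
stdAt : Word → ℕ → ℕ → ℕ
stdAt u p a = suc (countLt a u + countEq a (take p u))

stdPairs : Word → List (ℕ × ℕ) → List ℕ
stdPairs u [] = []
stdPairs u ((p , a) ∷ ps) = stdAt u p a ∷ stdPairs u ps

std : Word → List ℕ
std u = stdPairs u (zip (upTo (length u)) u)

-- 1-based position of j in w
indexOf : ℕ → List ℕ → ℕ
indexOf j [] = 0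
indexOf j (x ∷ xs) = if x ≡ᵇ j then 1 else suc (indexOf j xs)

invPerm : List ℕ → List ℕ
invPerm w = map (λ j → indexOf j w) (applyUpTo suc (length w))

data LTree : Set where
  lf : LTree
  nd : LTree → ℕ → LTree → LTree

data BTree : Set where
  leaf : BTree
  node : BTree → BTree → BTree

Sh : LTree → BTree
Sh lf = leaf
Sh (nd l _ r) = node (Sh l) (Sh r)

splitOn : ℕ → List ℕ → List ℕ × List ℕ
splitOn m [] = [] , []
splitOn m (x ∷ xs) with x ≡ᵇ m
... | true = [] , xs
... | false with splitOn m xs
...   | (s , t) = x ∷ s , t

-- fuel-based recursion; fuel = length w suffices
inctreeF : ℕ → List ℕ → LTree
inctreeF zero _ = lf
inctreeF (suc n) [] = lf
inctreeF (suc n) (x ∷ xs) with splitOn (foldr _⊓_ x xs) (x ∷ xs)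
... | (s , t) = nd (inctreeF n s) (foldr _⊓_ x xs) (inctreeF n t)

dectreeF : ℕ → List ℕ → LTree
dectreeF zero _ = lf
dectreeF (suc n) [] = lf
dectreeF (suc n) (x ∷ xs) with splitOn (foldr _⊔_ x xs) (x ∷ xs)
... | (s , t) = nd (dectreeF n s) (foldr _⊔_ x xs) (dectreeF n t)

inctree : List ℕ → LTree
inctree w = inctreeF (length w) w

dectree : List ℕ → LTree
dectree w = dectreeF (length w) w

σbaxt : Word → BTree × BTree
σbaxt u = Sh (inctree (invPerm (std u))) , Sh (dectree (invPerm (std u)))

insertR : ℕ → LTree → LTree
insertR a lf = nd lf a lf
insertR a (nd l b r) = if a ≤ᵇ b then nd (insertR a l) b r else nd l b (insertR a r)

insertL : ℕ → LTree → LTree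
insertL a lf = nd lf a lf
insertL a (nd l b r) = if b ≤ᵇ a then nd l b (insertL a r) else nd (insertL a l) b r

-- inserts a_k, ..., a_1
rtree : Word → LTree
rtree u = foldr insertR lf u

ltree : Word → LTree
ltree u = foldl (λ t a → insertL a t) lf u

_≡baxt_ : Word → Word → Set
u ≡baxt v = (ltree u ≡ ltree v) × (rtree u ≡ rtree v)

elemᵇ : ℕ → List ℕ → Bool
elemᵇ a [] = false
elemᵇ a (x ∷ xs) = (x ≡ᵇ a) ∨ elemᵇ a xs

blocked : ℕ → Word → Bool
blocked i [] = false
blocked i (x ∷ xs) = if x ≡ᵇ suc i then elemᵇ i xs else blocked i xs

replLeft : ℕ → ℕ → Word → Maybe Word
replLeft a b [] = nothing
replLeft a b (x ∷ xs) = if x ≡ᵇ a then just (b ∷ xs) else mmap (x ∷_) (replLeft a b xs)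

qe : ℕ → Word → Maybe Word
qe i u = if blocked i u then nothing else replLeft (suc i) i u

qf : ℕ → Word → Maybe Word
qf i u = if blocked i u then nothing else mmap reverse (replLeft i (suc i) (reverse u))

-- The graph Γ(hypo): edges u → qf i u labelled i; connected components

Step : Word → Word → Set
Step u w = ∃ λ i → qf i u ≡ just w

InComp : Word → Word → Set
InComp u w = Star (λ a b → Step a b ⊎ Step b a) u w

-- θ (restricted to Γ(hypo,u)) is a labelled directed graph isomorphism
-- Γ(hypo,u) → Γ(hypo,v).  θ is given as a function on all words; only its
-- restriction to Γ(hypo,u) matters.
record IsIso (u v : Word) (θ : Word → Word) : Set where
  field
    into  : ∀ w → InComp u w → InComp v (θ w)
    inj   : ∀ w w′ → InComp u w → InComp u w′ → θ w ≡ θ w′ → w ≡ w′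
    surj  : ∀ y → InComp v y → ∃ λ w → InComp u w × θ w ≡ y
    edges : ∀ i w w′ → InComp u w → InComp u w′ →
            (qf i w ≡ just w′) ⇔ (qf i (θ w) ≡ just (θ w′))

_∼baxt_ : Word → Word → Set
u ∼baxt v = Σ (Word → Word) λ θ →
  IsIso u v θ × (θ u ≡ v) × (∀ w → InComp u w → σbaxt (θ w) ≡ σbaxt w)

-- Sort the letters of a word u by (letter, position): the letters give its nondecreasing
-- rearrangement content u, and the positions give positions u = std(u)⁻¹. Then ltree u is the
-- shape of inctree (positions u) labelled in inorder by content u, and rtree u is the shape of
-- dectree (positions u) labelled the same way; so u ≡baxt v iff content u = content v and
-- σbaxt u = σbaxt v. An edge f̈ᵢ changes the letter of one such cell from i to i+1 without moving
-- it, so positions is constant on a component of Γ(hypo) and content changes in one entry.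
--
-- (⇐) Equal inctree shapes give positions u and positions v the same descents. Hence, on the
-- component of u, θ w := the word with content w and positions v is well defined, has the same
-- blocked operators as w, maps edges to edges, and is inverted by the same construction from v.
--
-- (⇒) Edges labelled j are the ones that remove a letter ≤ j, and θ preserves labels, so the
-- number of letters ≤ j in w minus that in θ w is constant on the component. From any word some
-- path reaches a word without letters ≤ j; applied on both sides this forces u and v to have
-- equally many letters ≤ j for every j, i.e. content u = content v. Finally σbaxt v = σbaxt (θ u)
-- = σbaxt u.

module Submission where

open import Defs
open import Algebra.Definitions using (Selective)
open import Data.Bool using (Bool; true; false; if_then_else_; not; T; T?; _∨_; _∧_)
open import Data.Bool.Properties using (T-≡; T-not-≡; not-involutive; ∨-identityʳ; ∧-identityʳ; ∧-zeroʳ)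
open import Data.Empty using (⊥; ⊥-elim)
open import Data.List
  using (List; []; _∷_; _++_; [_]; length; map; foldr; foldl; filterᵇ; zip; reverse; take; upTo; applyUpTo; initLast; _∷ʳ′_)
open import Data.List.Properties
  using ( ∷-injective; map-++; length-map; length-++; length-filter; length-applyUpTo; ++-assoc; ++-identityʳ
        ; foldr-++; filter-≐; reverse-++; reverse-involutive; unfold-reverse)
open import Data.List.Membership.Propositional using (_∈_; _∉_)
open import Data.List.Membership.Propositional.Properties
  using (∈-++⁺ˡ; ∈-++⁺ʳ; ∈-++⁻; ∈-map⁻; ∈-∃++; ∈-filter⁺; ∈-filter⁻; foldr-selective)
open import Data.List.Relation.Binary.Permutation.Propositional as ↭ using (_↭_; ↭-sym; ↭-trans)
open import Data.List.Relation.Binary.Permutation.Propositional.Properties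
  using (All-resp-↭; ∈-resp-↭; ↭-length; ↭-reverse; map⁺; shift; drop-mid)
open import Data.List.Relation.Unary.All as All using (All; []; _∷_)
open import Data.List.Relation.Unary.All.Properties as All using ()
open import Data.List.Relation.Unary.AllPairs as AllPairs using (AllPairs; []; _∷_)
open import Data.List.Relation.Unary.AllPairs.Properties as AllPairs using ()
open import Data.List.Relation.Unary.Any using (here; there)
open import Data.List.Relation.Unary.Linked using (Linked; []; [-]; _∷_)
open import Data.List.Relation.Unary.Linked.Properties using (AllPairs⇒Linked; Linked⇒AllPairs)
import Data.List.Relation.Unary.Unique.Propositional.Properties as Unique
open import Data.Maybe using (just)
open import Data.Nat using (ℕ; zero; suc; _+_; _∸_; _≤_; _<_; _>_; z≤n; s≤s; s≤s⁻¹; _≡ᵇ_; _<ᵇ_; _≤ᵇ_; _⊓_; _⊔_)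
open import Data.Nat.Properties
open import Data.Nat.Tactic.RingSolver using (solve-∀)
open import Data.Product using (∃; ∃₂; _×_; _,_; proj₁; proj₂; swap; uncurry)
open import Data.Product.Relation.Binary.Lex.Strict using (×-Lex; ×-transitive; ×-compare)
open import Data.Product.Relation.Binary.Pointwise.NonDependent using (≡×≡⇒≡; ≡⇒≡×≡)
open import Data.Sum using (_⊎_; inj₁; inj₂)
open import Data.Unit using (tt)
open import Function using (_∘_; _on_)
open import Function.Bundles using (_⇔_; mk⇔; Equivalence)
open import Level using (0ℓ)
open import Relation.Binary.Construct.Closure.ReflexiveTransitive using (Star; ε; _◅_; _◅◅_)
open import Relation.Binary.Core using (Rel)
open import Relation.Binary.Definitions using (Trichotomous; Transitive; tri<; tri≈; tri>)
open import Relation.Binary.PropositionalEquality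
  using (_≡_; _≢_; refl; sym; trans; cong; cong₂; subst; subst₂; isEquivalence; resp₂)
open import Relation.Nullary using (¬_)
open Relation.Binary.PropositionalEquality.≡-Reasoning

≡ᵇ⇒≡′ : ∀ {m n} → (m ≡ᵇ n) ≡ true → m ≡ n
≡ᵇ⇒≡′ = ≡ᵇ⇒≡ _ _ ∘ Equivalence.from T-≡

≡ᵇ-refl : ∀ m → (m ≡ᵇ m) ≡ true
≡ᵇ-refl m = Equivalence.to T-≡ (≡⇒≡ᵇ m m refl)

≢⇒≡ᵇ-false : ∀ {m n} → m ≢ n → (m ≡ᵇ n) ≡ false
≢⇒≡ᵇ-false {m} {n} m≢n with m ≡ᵇ n in eq
... | true = ⊥-elim (m≢n (≡ᵇ⇒≡′ eq))
... | false = refl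

≡ᵇ-false⇒≢ : ∀ {m n} → (m ≡ᵇ n) ≡ false → m ≢ n
≡ᵇ-false⇒≢ {m} eq refl with () ← trans (sym (≡ᵇ-refl m)) eq

<ᵇ⇒<′ : ∀ {m n} → (m <ᵇ n) ≡ true → m < n
<ᵇ⇒<′ = <ᵇ⇒< _ _ ∘ Equivalence.from T-≡

<⇒<ᵇ′ : ∀ {m n} → m < n → (m <ᵇ n) ≡ true
<⇒<ᵇ′ = Equivalence.to T-≡ ∘ <⇒<ᵇ

≤⇒<ᵇ-false : ∀ {m n} → n ≤ m → (m <ᵇ n) ≡ false
≤⇒<ᵇ-false {m} {n} n≤m with m <ᵇ n in eq
... | true = ⊥-elim (≤⇒≯ n≤m (<ᵇ⇒<′ eq))
... | false = refl

<ᵇ-false⇒≤ : ∀ {m n} → (m <ᵇ n) ≡ false → n ≤ m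
<ᵇ-false⇒≤ {m} {n} eq with <-cmp m n
... | tri< m<n _ _ with () ← trans (sym (<⇒<ᵇ′ m<n)) eq
... | tri≈ _ refl _ = ≤-refl
... | tri> _ _ n<m = <⇒≤ n<m

≤ᵇ⇒≤′ : ∀ {m n} → (m ≤ᵇ n) ≡ true → m ≤ n
≤ᵇ⇒≤′ = ≤ᵇ⇒≤ _ _ ∘ Equivalence.from T-≡

≤⇒≤ᵇ′ : ∀ {m n} → m ≤ n → (m ≤ᵇ n) ≡ true
≤⇒≤ᵇ′ = Equivalence.to T-≡ ∘ ≤⇒≤ᵇ

<⇒≤ᵇ-false : ∀ {m n} → n < m → (m ≤ᵇ n) ≡ false
<⇒≤ᵇ-false {suc m} (s≤s n≤m) = ≤⇒<ᵇ-false n≤m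

≤ᵇ-false⇒< : ∀ {m n} → (m ≤ᵇ n) ≡ false → n < m
≤ᵇ-false⇒< {zero} ()
≤ᵇ-false⇒< {suc m} eq = s≤s (<ᵇ-false⇒≤ eq)

bool-ext : ∀ {a b : Bool} → (a ≡ true → b ≡ true) → (b ≡ true → a ≡ true) → a ≡ b
bool-ext {false} {false} _ _ = refl
bool-ext {false} {true}  _ g = g refl
bool-ext {true}  {false} f _ = sym (f refl)
bool-ext {true}  {true}  _ _ = refl

ind : Bool → ℕ
ind b = if b then 1 else 0

count : ∀ {A : Set} → (A → Bool) → List A → ℕ
count p [] = 0
count p (x ∷ xs) = ind (p x) + count p xs

count-++ : ∀ {A : Set} (p : A → Bool) xs ys → count p (xs ++ ys) ≡ count p xs + count p ys
count-++ p [] ys = refl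
count-++ p (x ∷ xs) ys = trans (cong (ind (p x) +_) (count-++ p xs ys)) (sym (+-assoc (ind (p x)) _ _))

count-↭ : ∀ {A : Set} (p : A → Bool) {xs ys} → xs ↭ ys → count p xs ≡ count p ys
count-↭ p ↭.refl = refl
count-↭ p (↭.prep x r) = cong (ind (p x) +_) (count-↭ p r)
count-↭ p (↭.swap {xs} {ys} x y r) = begin
  ind (p x) + (ind (p y) + count p xs) ≡⟨ sym (+-assoc (ind (p x)) _ _) ⟩
  ind (p x) + ind (p y) + count p xs   ≡⟨ cong₂ _+_ (+-comm (ind (p x)) _) (count-↭ p r) ⟩
  ind (p y) + ind (p x) + count p ys   ≡⟨ +-assoc (ind (p y)) _ _ ⟩
  ind (p y) + (ind (p x) + count p ys) ∎
count-↭ p (↭.trans r s) = trans (count-↭ p r) (count-↭ p s)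

count-split : ∀ {A : Set} (p q r : A → Bool) → (∀ x → ind (p x) ≡ ind (q x) + ind (r x)) →
              ∀ w → count p w ≡ count q w + count r w
count-split p q r split [] = refl
count-split p q r split (x ∷ w) rewrite split x | count-split p q r split w =
  interchange (ind (q x)) (ind (r x)) (count q w) (count r w)
  where
  interchange : ∀ a b c d → (a + b) + (c + d) ≡ (a + c) + (b + d)
  interchange = solve-∀

count≤length : ∀ {A : Set} (p : A → Bool) w → count p w ≤ length w
count≤length p [] = z≤n
count≤length p (x ∷ w) with p x
... | true = s≤s (count≤length p w)
... | false = m≤n⇒m≤1+n (count≤length p w)

count-pos : ∀ {A : Set} (p : A → Bool) {x xs} → x ∈ xs → p x ≡ true → 1 ≤ count p xs
count-pos p {xs = y ∷ xs} (here refl) px rewrite px = s≤s z≤n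
count-pos p {xs = y ∷ xs} (there x∈) px = ≤-trans (count-pos p x∈ px) (m≤n+m (count p xs) (ind (p y)))

count-nonzero : ∀ {A : Set} (p : A → Bool) w → count p w ≢ 0 → ∃ λ x → x ∈ w × p x ≡ true
count-nonzero p [] nz = ⊥-elim (nz refl)
count-nonzero p (x ∷ w) nz with p x in e
... | true = x , here refl , e
... | false with count-nonzero p w nz
...   | y , y∈ , e′ = y , there y∈ , e′

module StrictSorting {A : Set} {_≺_ : Rel A 0ℓ}
  (compare : Trichotomous _≡_ _≺_) (≺-trans : Transitive _≺_) where

  ≺-irrefl : ∀ {x} → x ≺ x → ⊥
  ≺-irrefl {x} x≺x with compare x x
  ... | tri< _ _ x⊀x = x⊀x x≺x
  ... | tri≈ x⊀x _ _ = x⊀x x≺x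
  ... | tri> x⊀x _ _ = x⊀x x≺x

  ≺-asym : ∀ {x y} → x ≺ y → y ≺ x → ⊥
  ≺-asym p q = ≺-irrefl (≺-trans p q)

  insert : A → List A → List A
  insert x [] = x ∷ []
  insert x (y ∷ ys) with compare x y
  ... | tri> _ _ _ = y ∷ insert x ys
  ... | _ = x ∷ y ∷ ys

  isort : List A → List A
  isort [] = []
  isort (x ∷ xs) = insert x (isort xs)

  insert-↭ : ∀ x ys → insert x ys ↭ x ∷ ys
  insert-↭ x [] = ↭.refl
  insert-↭ x (y ∷ ys) with compare x y
  ... | tri< _ _ _ = ↭.refl
  ... | tri≈ _ _ _ = ↭.refl
  ... | tri> _ _ _ = ↭-trans (↭.prep y (insert-↭ x ys)) (↭.swap y x ↭.refl)

  isort-↭ : ∀ xs → isort xs ↭ xs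
  isort-↭ [] = ↭.refl
  isort-↭ (x ∷ xs) = ↭-trans (insert-↭ x (isort xs)) (↭.prep x (isort-↭ xs))

  All-≺-trans : ∀ {x y ys} → x ≺ y → All (y ≺_) ys → All (x ≺_) ys
  All-≺-trans x≺y = All.map (≺-trans x≺y)

  insert-sorted : ∀ {x} ys → AllPairs _≺_ ys → All (x ≢_) ys → AllPairs _≺_ (insert x ys)
  insert-sorted [] [] _ = [] ∷ []
  insert-sorted {x} (y ∷ ys) (y≺ys ∷ ys↑) (x≢y ∷ x∉ys) with compare x y
  ... | tri< x≺y _ _ = (x≺y ∷ All-≺-trans x≺y y≺ys) ∷ y≺ys ∷ ys↑
  ... | tri≈ _ x≡y _ = ⊥-elim (x≢y x≡y)
  ... | tri> _ _ y≺x = All-resp-↭ (↭-sym (insert-↭ x ys)) (y≺x ∷ y≺ys) ∷ insert-sorted ys ys↑ x∉ys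

  isort-sorted : ∀ {xs} → AllPairs _≢_ xs → AllPairs _≺_ (isort xs)
  isort-sorted [] = []
  isort-sorted {x ∷ xs} (x∉xs ∷ xs!) =
    insert-sorted (isort xs) (isort-sorted xs!) (All-resp-↭ (↭-sym (isort-↭ xs)) x∉xs)

  sorted⇒unique : ∀ {xs} → AllPairs _≺_ xs → AllPairs _≢_ xs
  sorted⇒unique = AllPairs.map λ { x≺y refl → ≺-irrefl x≺y }

  sorted-unique : ∀ {xs ys} → AllPairs _≺_ xs → AllPairs _≺_ ys →
                  (∀ {z} → z ∈ xs → z ∈ ys) → (∀ {z} → z ∈ ys → z ∈ xs) → xs ≡ ys
  sorted-unique [] [] _ _ = refl
  sorted-unique [] (_ ∷ _) _ g with () ← g (here refl)
  sorted-unique (_ ∷ _) [] f _ with () ← f (here refl)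
  sorted-unique {x ∷ xs} {y ∷ ys} (x≺xs ∷ xs↑) (y≺ys ∷ ys↑) f g =
    cong₂ _∷_ x≡y (sorted-unique xs↑ ys↑ f′ g′)
    where
    x≡y : x ≡ y
    x≡y with f (here refl) | g (here refl)
    ... | here e | _ = e
    ... | there _ | here e = sym e
    ... | there y∈ys | there x∈xs = ⊥-elim (≺-asym (All.lookup y≺ys y∈ys) (All.lookup x≺xs x∈xs))
    f′ : ∀ {z} → z ∈ xs → z ∈ ys
    f′ z∈xs with f (there z∈xs)
    ... | there z∈ys = z∈ys
    ... | here refl = ⊥-elim (≺-irrefl (subst (x ≺_) (sym x≡y) (All.lookup x≺xs z∈xs)))
    g′ : ∀ {z} → z ∈ ys → z ∈ xs
    g′ z∈ys with g (there z∈ys)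
    ... | there z∈xs = z∈xs
    ... | here refl = ⊥-elim (≺-irrefl (subst (y ≺_) x≡y (All.lookup y≺ys z∈ys)))

  ++-sorted : ∀ {xs x ys} → AllPairs _≺_ xs → All (_≺ x) xs → All (x ≺_) ys → AllPairs _≺_ ys →
              AllPairs _≺_ (xs ++ x ∷ ys)
  ++-sorted {[]} [] [] x≺ys ys↑ = x≺ys ∷ ys↑
  ++-sorted {z ∷ zs} {x} {ys} (z≺zs ∷ zs↑) (z≺x ∷ zs≺x) x≺ys ys↑ = below z≺zs ∷ ++-sorted zs↑ zs≺x x≺ys ys↑
    where
    below : ∀ {l} → All (z ≺_) l → All (z ≺_) (l ++ x ∷ ys)
    below [] = z≺x ∷ All-≺-trans z≺x x≺ys
    below (q ∷ qs) = q ∷ below qs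

  sorted-split : ∀ xs {x ys} → AllPairs _≺_ (xs ++ x ∷ ys) →
                 AllPairs _≺_ xs × All (_≺ x) xs × All (x ≺_) ys × AllPairs _≺_ ys
  sorted-split [] (x≺ys ∷ ys↑) = [] , [] , x≺ys , ys↑
  sorted-split (z ∷ zs) (z≺ ∷ rest) with sorted-split zs rest
  ... | zs↑ , zs≺x , x≺ys , ys↑ =
    All.++⁻ˡ zs z≺ ∷ zs↑ , All.lookup z≺ (∈-++⁺ʳ zs (here refl)) ∷ zs≺x , x≺ys , ys↑

  ∈-isort⁻ : ∀ {z xs} → z ∈ isort xs → z ∈ xs
  ∈-isort⁻ {xs = xs} = ∈-resp-↭ (isort-↭ xs)

  ∈-isort⁺ : ∀ {z xs} → z ∈ xs → z ∈ isort xs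
  ∈-isort⁺ {xs = xs} = ∈-resp-↭ (↭-sym (isort-↭ xs))

  isort-↭-cong : ∀ {xs ys} → AllPairs _≢_ xs → AllPairs _≢_ ys → xs ↭ ys → isort xs ≡ isort ys
  isort-↭-cong xs! ys! xs↭ys = sorted-unique (isort-sorted xs!) (isort-sorted ys!)
    (∈-isort⁺ ∘ ∈-resp-↭ xs↭ys ∘ ∈-isort⁻) (∈-isort⁺ ∘ ∈-resp-↭ (↭-sym xs↭ys) ∘ ∈-isort⁻)

  isort-pivot : ∀ (p : A → Bool) {x xs} → AllPairs _≢_ (x ∷ xs) →
    (∀ {z} → z ∈ xs → T (p z) → z ≺ x) → (∀ {z} → z ∈ xs → T (not (p z)) → x ≺ z) →
    isort (x ∷ xs) ≡ isort (filterᵇ p xs) ++ x ∷ isort (filterᵇ (not ∘ p) xs)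
  isort-pivot p {x} {xs} x!xs@(_ ∷ xs!) below above = sorted-unique
    (isort-sorted x!xs)
    (++-sorted (isort-sorted (Unique.filter⁺ (T? ∘ p) xs!))
      (All.tabulate (λ z∈ → uncurry below (∈-filter⁻ (T? ∘ p) (∈-isort⁻ z∈))))
      (All.tabulate (λ z∈ → uncurry above (∈-filter⁻ (T? ∘ not ∘ p) (∈-isort⁻ z∈))))
      (isort-sorted (Unique.filter⁺ (T? ∘ not ∘ p) xs!)))
    (into ∘ ∈-isort⁻) (∈-isort⁺ ∘ outof)
    where
    into : ∀ {z} → z ∈ x ∷ xs → z ∈ isort (filterᵇ p xs) ++ x ∷ isort (filterᵇ (not ∘ p) xs)
    into (here refl) = ∈-++⁺ʳ _ (here refl)
    into {z} (there z∈) with p z in eq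
    ... | true = ∈-++⁺ˡ (∈-isort⁺ (∈-filter⁺ (T? ∘ p) z∈ (subst T (sym eq) tt)))
    ... | false = ∈-++⁺ʳ _ (there (∈-isort⁺ (∈-filter⁺ (T? ∘ not ∘ p) z∈ (subst (T ∘ not) (sym eq) tt))))
    outof : ∀ {z} → z ∈ isort (filterᵇ p xs) ++ x ∷ isort (filterᵇ (not ∘ p) xs) → z ∈ x ∷ xs
    outof z∈ with ∈-++⁻ (isort (filterᵇ p xs)) z∈
    ... | inj₁ z∈l = there (proj₁ (∈-filter⁻ (T? ∘ p) (∈-isort⁻ z∈l)))
    ... | inj₂ (here refl) = here refl
    ... | inj₂ (there z∈r) = there (proj₁ (∈-filter⁻ (T? ∘ not ∘ p) (∈-isort⁻ z∈r)))

Cell : Set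
Cell = ℕ × ℕ

_<ₗₑₓ_ : Rel Cell 0ℓ
_<ₗₑₓ_ = ×-Lex _≡_ _<_ _<_

<ₗₑₓ-trans : Transitive _<ₗₑₓ_
<ₗₑₓ-trans = ×-transitive {_≈₁_ = _≡_} {_<₁_ = _<_} {_<₂_ = _<_} isEquivalence (resp₂ _<_) <-trans <-trans

<ₗₑₓ-compare : Trichotomous _≡_ _<ₗₑₓ_
<ₗₑₓ-compare x y with ×-compare sym <-cmp <-cmp x y
... | tri< a b c = tri< a (b ∘ ≡⇒≡×≡) c
... | tri≈ a b c = tri≈ a (≡×≡⇒≡ b) c
... | tri> a b c = tri> a (b ∘ ≡⇒≡×≡) c

_<ₚ_ : Rel Cell 0ℓ
x <ₚ y = swap x <ₗₑₓ swap y

<ₚ-compare : Trichotomous _≡_ _<ₚ_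
<ₚ-compare x y with <ₗₑₓ-compare (swap x) (swap y)
... | tri< a b c = tri< a (b ∘ cong swap) c
... | tri≈ a b c = tri≈ a (cong swap b) c
... | tri> a b c = tri> a (b ∘ cong swap) c

module Lex = StrictSorting <ₗₑₓ-compare <ₗₑₓ-trans
module ByPosition = StrictSorting <ₚ-compare <ₗₑₓ-trans

indexed : ℕ → Word → List Cell
indexed n [] = []
indexed n (x ∷ xs) = (x , n) ∷ indexed (suc n) xs

-- The letters of w sorted with ties broken by position (positions counted from 1),
-- i.e. the nondecreasing rearrangement of w zipped with std(w)⁻¹.
cells : Word → List Cell
cells w = Lex.isort (indexed 1 w)

content : Word → List ℕ
content w = map proj₁ (cells w)

positions : Word → List ℕ
positions w = map proj₂ (cells w)

uncells : List Cell → Word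
uncells zs = map proj₁ (ByPosition.isort zs)

TagIncreasing : List Cell → Set
TagIncreasing = AllPairs (_<_ on proj₂)

tagIncreasing⇒unique : ∀ {zs} → TagIncreasing zs → AllPairs _≢_ zs
tagIncreasing⇒unique = AllPairs.map λ { t<t′ refl → <-irrefl refl t<t′ }

indexed-tag≥ : ∀ n xs {a q} → (a , q) ∈ indexed n xs → n ≤ q
indexed-tag≥ n (x ∷ xs) (here refl) = ≤-refl
indexed-tag≥ n (x ∷ xs) (there m) = ≤-trans (n≤1+n n) (indexed-tag≥ (suc n) xs m)

indexed-tag< : ∀ n xs {a q} → (a , q) ∈ indexed n xs → q < n + length xs
indexed-tag< n (x ∷ xs) (here refl) = subst (n <_) (sym (+-suc n (length xs))) (s≤s (m≤m+n n _))
indexed-tag< n (x ∷ xs) {q = q} (there m) = subst (q <_) (sym (+-suc n (length xs))) (indexed-tag< (suc n) xs m)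

indexed-tagIncreasing : ∀ n xs → TagIncreasing (indexed n xs)
indexed-tagIncreasing n [] = []
indexed-tagIncreasing n (x ∷ xs) =
  All.tabulate (λ { {_ , q} m → indexed-tag≥ (suc n) xs m }) ∷ indexed-tagIncreasing (suc n) xs

∈-indexed⁻ : ∀ n xs {a q} → (a , q) ∈ indexed n xs → a ∈ xs
∈-indexed⁻ n (x ∷ xs) (here refl) = here refl
∈-indexed⁻ n (x ∷ xs) (there m) = there (∈-indexed⁻ (suc n) xs m)

∈-indexed⁺ : ∀ n xs {a} → a ∈ xs → ∃ λ q → (a , q) ∈ indexed n xs
∈-indexed⁺ n (x ∷ xs) (here refl) = n , here refl
∈-indexed⁺ n (x ∷ xs) (there m) with ∈-indexed⁺ (suc n) xs m
... | q , m′ = q , there m′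

length-indexed : ∀ n xs → length (indexed n xs) ≡ length xs
length-indexed n [] = refl
length-indexed n (x ∷ xs) = cong suc (length-indexed (suc n) xs)

map-proj₁-indexed : ∀ n xs → map proj₁ (indexed n xs) ≡ xs
map-proj₁-indexed n [] = refl
map-proj₁-indexed n (x ∷ xs) = cong (x ∷_) (map-proj₁-indexed (suc n) xs)

indexed-++ : ∀ n xs ys → indexed n (xs ++ ys) ≡ indexed n xs ++ indexed (n + length xs) ys
indexed-++ n [] ys = cong (λ k → indexed k ys) (sym (+-identityʳ n))
indexed-++ n (x ∷ xs) ys = cong ((x , n) ∷_)
  (trans (indexed-++ (suc n) xs ys) (cong (λ k → indexed (suc n) xs ++ indexed k ys) (sym (+-suc n (length xs)))))

indexed-tag-unique : ∀ n xs {a b q} → (a , q) ∈ indexed n xs → (b , q) ∈ indexed n xs → a ≡ b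
indexed-tag-unique n (x ∷ xs) (here refl) (here refl) = refl
indexed-tag-unique n (x ∷ xs) (here refl) (there m) = ⊥-elim (<-irrefl refl (indexed-tag≥ (suc n) xs m))
indexed-tag-unique n (x ∷ xs) (there m) (here refl) = ⊥-elim (<-irrefl refl (indexed-tag≥ (suc n) xs m))
indexed-tag-unique n (x ∷ xs) (there m) (there m′) = indexed-tag-unique (suc n) xs m m′

cells-↭ : ∀ w → cells w ↭ indexed 1 w
cells-↭ w = Lex.isort-↭ (indexed 1 w)

cells-sorted : ∀ w → AllPairs _<ₗₑₓ_ (cells w)
cells-sorted w = Lex.isort-sorted (tagIncreasing⇒unique (indexed-tagIncreasing 1 w))

∈-cells⁻ : ∀ {w z} → z ∈ cells w → z ∈ indexed 1 w
∈-cells⁻ {w} = ∈-resp-↭ (cells-↭ w)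

∈-cells⁺ : ∀ {w z} → z ∈ indexed 1 w → z ∈ cells w
∈-cells⁺ {w} = ∈-resp-↭ (↭-sym (cells-↭ w))

cells-tag-unique : ∀ w {a b q} → (a , q) ∈ cells w → (b , q) ∈ cells w → a ≡ b
cells-tag-unique w m m′ = indexed-tag-unique 1 w (∈-cells⁻ m) (∈-cells⁻ m′)

length-cells : ∀ w → length (cells w) ≡ length w
length-cells w = trans (↭-length (cells-↭ w)) (length-indexed 1 w)

length-content : ∀ w → length (content w) ≡ length w
length-content w = trans (length-map proj₁ (cells w)) (length-cells w)

length-positions : ∀ w → length (positions w) ≡ length w
length-positions w = trans (length-map proj₂ (cells w)) (length-cells w)

uncells-cells : ∀ w → uncells (cells w) ≡ w
uncells-cells w = trans (cong (map proj₁) byPosition) (map-proj₁-indexed 1 w)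
  where
  byPosition : ByPosition.isort (cells w) ≡ indexed 1 w
  byPosition = ByPosition.sorted-unique
    (ByPosition.isort-sorted (Lex.sorted⇒unique (cells-sorted w)))
    (AllPairs.map inj₁ (indexed-tagIncreasing 1 w))
    (∈-cells⁻ ∘ ∈-resp-↭ (ByPosition.isort-↭ (cells w)))
    (∈-resp-↭ (↭-sym (ByPosition.isort-↭ (cells w))) ∘ ∈-cells⁺)

cells-injective : ∀ {v w} → cells v ≡ cells w → v ≡ w
cells-injective {v} {w} e = trans (sym (uncells-cells v)) (trans (cong uncells e) (uncells-cells w))

size : BTree → ℕ
size leaf = 0
size (node l r) = suc (size l + size r)

inorder : LTree → List ℕ
inorder lf = []
inorder (nd l a r) = inorder l ++ a ∷ inorder r

-- consumes labels from the front; the junk label 0 is used only when labels run out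
mutual
  fill : BTree → List ℕ → LTree × List ℕ
  fill leaf l = lf , l
  fill (node s₁ s₂) l = fillRoot s₂ (fill s₁ l)

  fillRoot : BTree → LTree × List ℕ → LTree × List ℕ
  fillRoot s₂ (t₁ , []) = nd t₁ 0 (proj₁ (fill s₂ [])) , proj₂ (fill s₂ [])
  fillRoot s₂ (t₁ , a ∷ l) = nd t₁ a (proj₁ (fill s₂ l)) , proj₂ (fill s₂ l)

fillInorder : BTree → List ℕ → LTree
fillInorder s l = proj₁ (fill s l)

Sh-fillInorder : ∀ s l → Sh (fillInorder s l) ≡ s
Sh-fillInorder leaf l = refl
Sh-fillInorder (node s₁ s₂) l with fill s₁ l | Sh-fillInorder s₁ l
... | t₁ , [] | e = cong₂ node e (Sh-fillInorder s₂ [])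
... | t₁ , a ∷ l′ | e = cong₂ node e (Sh-fillInorder s₂ l′)

split-at : ∀ {A : Set} (l : List A) m n → length l ≡ suc (m + n) →
           ∃ λ l₁ → ∃ λ a → ∃ λ l₂ → l ≡ l₁ ++ a ∷ l₂ × length l₁ ≡ m × length l₂ ≡ n
split-at (a ∷ l) zero n e = [] , a , l , refl , refl , suc-injective e
split-at (x ∷ l) (suc m) n e with split-at l m n (suc-injective e)
... | l₁ , a , l₂ , refl , p , q = x ∷ l₁ , a , l₂ , refl , cong suc p , q

fill-++ : ∀ s l r → length l ≡ size s → fill s (l ++ r) ≡ (fillInorder s l , r) × inorder (fillInorder s l) ≡ l
fill-++ leaf [] r e = refl , refl
fill-++ (node s₁ s₂) l r e with split-at l (size s₁) (size s₂) e
... | l₁ , a , l₂ , refl , p , q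
  with fill-++ s₁ l₁ (a ∷ l₂ ++ r) p | fill-++ s₁ l₁ (a ∷ l₂) p | fill-++ s₂ l₂ r q | fill-++ s₂ l₂ [] q
... | e₁ , i₁ | e₁′ , _ | e₂ , i₂ | e₂′ , _
  rewrite ++-assoc l₁ (a ∷ l₂) r | e₁ | e₁′ | e₂ | ++-identityʳ l₂ | e₂′ = refl , cong₂ _++_ i₁ (cong (a ∷_) i₂)

fillInorder-node : ∀ s₁ s₂ l₁ a l₂ → length l₁ ≡ size s₁ → length l₂ ≡ size s₂ →
                   fillInorder (node s₁ s₂) (l₁ ++ a ∷ l₂) ≡ nd (fillInorder s₁ l₁) a (fillInorder s₂ l₂)
fillInorder-node s₁ s₂ l₁ a l₂ p q with fill-++ s₁ l₁ (a ∷ l₂) p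
... | e , _ rewrite e with fill-++ s₂ l₂ [] q
... | e′ , _ rewrite ++-identityʳ l₂ | e′ = refl

inorder-fillInorder : ∀ s l → length l ≡ size s → inorder (fillInorder s l) ≡ l
inorder-fillInorder s l e = proj₂ (fill-++ s l [] e)

-- Cartesian trees, covering inctree (⊙ = ⊓, ⊏ = <) and dectree (⊙ = ⊔, ⊏ = >)

splitOn-++ : ∀ m l₁ l₂ → m ∉ l₁ → splitOn m (l₁ ++ m ∷ l₂) ≡ (l₁ , l₂)
splitOn-++ m [] l₂ _ rewrite ≡ᵇ-refl m = refl
splitOn-++ m (y ∷ l₁) l₂ m∉ with y ≡ᵇ m in eq
... | true = ⊥-elim (m∉ (here (sym (≡ᵇ⇒≡′ eq))))
... | false rewrite splitOn-++ m l₁ l₂ (m∉ ∘ there) = refl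

splitOn-∈ : ∀ m l → m ∈ l → l ≡ proj₁ (splitOn m l) ++ m ∷ proj₂ (splitOn m l)
splitOn-∈ m (y ∷ l) m∈ with y ≡ᵇ m in eq
... | true = cong (_∷ l) (≡ᵇ⇒≡′ eq)
... | false with m∈
...   | here e = ⊥-elim (≡ᵇ-false⇒≢ eq (sym e))
...   | there m∈′ with splitOn m l | splitOn-∈ m l m∈′
...     | s , t | e = cong (y ∷_) e

length-splitOn : ∀ m l → m ∈ l → suc (length (proj₁ (splitOn m l)) + length (proj₂ (splitOn m l))) ≡ length l
length-splitOn m l m∈ = begin
  suc (length s + length t)  ≡⟨ sym (+-suc (length s) (length t)) ⟩
  length s + length (m ∷ t)  ≡⟨ sym (length-++ s) ⟩
  length (s ++ m ∷ t)        ≡⟨ cong length (sym (splitOn-∈ m l m∈)) ⟩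
  length l                   ∎
  where s = proj₁ (splitOn m l); t = proj₂ (splitOn m l)

module Cartesian (_⊙_ : ℕ → ℕ → ℕ) (⊙-sel : Selective _≡_ _⊙_) (⊙-idem : ∀ m → m ⊙ m ≡ m)
  (_⊏_ : Rel ℕ 0ℓ) (⊏-irrefl : ∀ {m} → m ⊏ m → ⊥)
  (⊏⇒⊙ˡ : ∀ {m e} → m ⊏ e → m ⊙ e ≡ m) (⊏⇒⊙ʳ : ∀ {m e} → m ⊏ e → e ⊙ m ≡ m) where

  treeF : ℕ → List ℕ → LTree
  treeF zero _ = lf
  treeF (suc n) [] = lf
  treeF (suc n) (x ∷ xs) with splitOn (foldr _⊙_ x xs) (x ∷ xs)
  ... | s , t = nd (treeF n s) (foldr _⊙_ x xs) (treeF n t)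

  tree : List ℕ → LTree
  tree l = treeF (length l) l

  treeF-∷ : ∀ n x xs → treeF (suc n) (x ∷ xs) ≡
    nd (treeF n (proj₁ (splitOn (foldr _⊙_ x xs) (x ∷ xs)))) (foldr _⊙_ x xs)
       (treeF n (proj₂ (splitOn (foldr _⊙_ x xs) (x ∷ xs))))
  treeF-∷ n x xs with splitOn (foldr _⊙_ x xs) (x ∷ xs)
  ... | s , t = refl

  fold-∈ : ∀ x xs → foldr _⊙_ x xs ∈ x ∷ xs
  fold-∈ x xs with foldr-selective ⊙-sel x xs
  ... | inj₁ e = here e
  ... | inj₂ m = there m

  private
    absorbˡ : ∀ {m e} → m ≡ e ⊎ m ⊏ e → m ⊙ e ≡ m
    absorbˡ (inj₁ refl) = ⊙-idem _
    absorbˡ (inj₂ m⊏e) = ⊏⇒⊙ˡ m⊏e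

    absorbʳ : ∀ {m e} → m ≡ e ⊎ m ⊏ e → e ⊙ m ≡ m
    absorbʳ (inj₁ refl) = ⊙-idem _
    absorbʳ (inj₂ m⊏e) = ⊏⇒⊙ʳ m⊏e

  fold-extremum : ∀ {m} x xs → m ∈ x ∷ xs → All (λ e → m ≡ e ⊎ m ⊏ e) (x ∷ xs) → foldr _⊙_ x xs ≡ m
  fold-extremum x [] (here refl) _ = refl
  fold-extremum x (y ∷ ys) m∈ (mx ∷ my ∷ mys) with m∈
  ... | here refl = trans (cong (y ⊙_) (fold-extremum x ys (here refl) (mx ∷ mys))) (absorbʳ my)
  ... | there (there m∈ys) = trans (cong (y ⊙_) (fold-extremum x ys (there m∈ys) (mx ∷ mys))) (absorbʳ my)
  ... | there (here refl) = absorbˡ (All.lookup (mx ∷ mys) (fold-∈ x ys))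

  private
    length≤-parts : ∀ {n} x xs → length (x ∷ xs) ≤ suc n →
      let m = foldr _⊙_ x xs in
      length (proj₁ (splitOn m (x ∷ xs))) ≤ n × length (proj₂ (splitOn m (x ∷ xs))) ≤ n
    length≤-parts x xs (s≤s len≤) with length-splitOn (foldr _⊙_ x xs) (x ∷ xs) (fold-∈ x xs)
    ... | e = ≤-trans (m≤m+n _ _) (≤-trans (≤-reflexive (suc-injective e)) len≤)
            , ≤-trans (m≤n+m _ _) (≤-trans (≤-reflexive (suc-injective e)) len≤)

  treeF-fuel : ∀ n k l → length l ≤ n → length l ≤ k → treeF n l ≡ treeF k l
  treeF-fuel zero zero [] _ _ = refl
  treeF-fuel zero (suc k) [] _ _ = refl
  treeF-fuel (suc n) zero [] _ _ = refl
  treeF-fuel (suc n) (suc k) [] _ _ = refl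
  treeF-fuel (suc n) (suc k) (x ∷ xs) ≤n ≤k =
    trans (treeF-∷ n x xs) (trans (cong₂ (λ a b → nd a (foldr _⊙_ x xs) b)
      (treeF-fuel n k _ (proj₁ (length≤-parts x xs ≤n)) (proj₁ (length≤-parts x xs ≤k)))
      (treeF-fuel n k _ (proj₂ (length≤-parts x xs ≤n)) (proj₂ (length≤-parts x xs ≤k))))
      (sym (treeF-∷ k x xs)))

  tree-∷ : ∀ x xs → tree (x ∷ xs) ≡
    nd (tree (proj₁ (splitOn (foldr _⊙_ x xs) (x ∷ xs)))) (foldr _⊙_ x xs)
       (tree (proj₂ (splitOn (foldr _⊙_ x xs) (x ∷ xs))))
  tree-∷ x xs = trans (treeF-∷ (length xs) x xs) (cong₂ (λ a b → nd a (foldr _⊙_ x xs) b)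
    (treeF-fuel _ _ _ (proj₁ (length≤-parts x xs ≤-refl)) ≤-refl)
    (treeF-fuel _ _ _ (proj₂ (length≤-parts x xs ≤-refl)) ≤-refl))

  tree-split : ∀ l₁ m l₂ → All (m ⊏_) l₁ → All (m ⊏_) l₂ → tree (l₁ ++ m ∷ l₂) ≡ nd (tree l₁) m (tree l₂)
  tree-split l₁ m l₂ m⊏l₁ m⊏l₂ = go (l₁ ++ m ∷ l₂) refl
    where
    m∉l₁ : m ∉ l₁
    m∉l₁ m∈ = ⊏-irrefl (All.lookup m⊏l₁ m∈)
    m-extremal : All (λ e → m ≡ e ⊎ m ⊏ e) (l₁ ++ m ∷ l₂)
    m-extremal = All.++⁺ (All.map inj₂ m⊏l₁) (inj₁ refl ∷ All.map inj₂ m⊏l₂)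
    go : ∀ l → l ≡ l₁ ++ m ∷ l₂ → tree l ≡ nd (tree l₁) m (tree l₂)
    go [] e with () ← subst (m ∈_) (sym e) (∈-++⁺ʳ l₁ (here refl))
    go (x ∷ xs) e = begin
      tree (x ∷ xs)                                        ≡⟨ tree-∷ x xs ⟩
      nd (tree (proj₁ (sp r))) r (tree (proj₂ (sp r)))     ≡⟨ cong (λ k → nd (tree (proj₁ (sp k))) k (tree (proj₂ (sp k)))) r≡m ⟩
      nd (tree (proj₁ (sp m))) m (tree (proj₂ (sp m)))     ≡⟨ cong (λ p → nd (tree (proj₁ p)) m (tree (proj₂ p))) sp-m ⟩
      nd (tree l₁) m (tree l₂)                             ∎
      where
      r = foldr _⊙_ x xs
      sp : ℕ → List ℕ × List ℕ
      sp k = splitOn k (x ∷ xs)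
      r≡m : r ≡ m
      r≡m = fold-extremum x xs (subst (m ∈_) (sym e) (∈-++⁺ʳ l₁ (here refl))) (subst (All _) (sym e) m-extremal)
      sp-m : sp m ≡ (l₁ , l₂)
      sp-m = trans (cong (splitOn m) e) (splitOn-++ m l₁ l₂ m∉l₁)

  size-treeF : ∀ n l → length l ≤ n → size (Sh (treeF n l)) ≡ length l
  size-treeF zero [] _ = refl
  size-treeF (suc n) [] _ = refl
  size-treeF (suc n) (x ∷ xs) len≤ rewrite treeF-∷ n x xs =
    trans (cong suc (cong₂ _+_ (size-treeF n _ (proj₁ (length≤-parts x xs len≤)))
                               (size-treeF n _ (proj₂ (length≤-parts x xs len≤)))))
          (length-splitOn (foldr _⊙_ x xs) (x ∷ xs) (fold-∈ x xs))

  size-tree : ∀ l → size (Sh (tree l)) ≡ length l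
  size-tree l = size-treeF (length l) l ≤-refl

  labelled : List Cell → LTree
  labelled zs = fillInorder (Sh (tree (map proj₂ zs))) (map proj₁ zs)

  labelled-split : ∀ zs₁ a t zs₂ → All ((t ⊏_) ∘ proj₂) zs₁ → All ((t ⊏_) ∘ proj₂) zs₂ →
                   labelled (zs₁ ++ (a , t) ∷ zs₂) ≡ nd (labelled zs₁) a (labelled zs₂)
  labelled-split zs₁ a t zs₂ t⊏zs₁ t⊏zs₂ = begin
    fillInorder (Sh (tree (map proj₂ (zs₁ ++ (a , t) ∷ zs₂)))) (map proj₁ (zs₁ ++ (a , t) ∷ zs₂))
      ≡⟨ cong₂ (λ π c → fillInorder (Sh (tree π)) c) (map-++ proj₂ zs₁ _) (map-++ proj₁ zs₁ _) ⟩
    fillInorder (Sh (tree (map proj₂ zs₁ ++ t ∷ map proj₂ zs₂))) (map proj₁ zs₁ ++ a ∷ map proj₁ zs₂)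
      ≡⟨ cong (λ τ → fillInorder (Sh τ) _) (tree-split _ t _ (All.map⁺ t⊏zs₁) (All.map⁺ t⊏zs₂)) ⟩
    fillInorder (node (Sh (tree (map proj₂ zs₁))) (Sh (tree (map proj₂ zs₂)))) (map proj₁ zs₁ ++ a ∷ map proj₁ zs₂)
      ≡⟨ fillInorder-node _ _ _ a _ (fits zs₁) (fits zs₂) ⟩
    nd (labelled zs₁) a (labelled zs₂) ∎
    where
    fits : ∀ zs → length (map proj₁ zs) ≡ size (Sh (tree (map proj₂ zs)))
    fits zs = trans (length-map proj₁ zs) (sym (trans (size-tree _) (length-map proj₂ zs)))

module Inc = Cartesian _⊓_ ⊓-sel ⊓-idem _<_ (<-irrefl refl) (m≤n⇒m⊓n≡m ∘ <⇒≤) (m≥n⇒m⊓n≡n ∘ <⇒≤)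
module Dec = Cartesian _⊔_ ⊔-sel ⊔-idem _>_ (<-irrefl refl) (m≥n⇒m⊔n≡m ∘ <⇒≤) (m≤n⇒m⊔n≡n ∘ <⇒≤)

inctreeF≡treeF : ∀ n l → inctreeF n l ≡ Inc.treeF n l
inctreeF≡treeF zero l = refl
inctreeF≡treeF (suc n) [] = refl
inctreeF≡treeF (suc n) (x ∷ xs) with splitOn (foldr _⊓_ x xs) (x ∷ xs)
... | s , t = cong₂ (λ a b → nd a (foldr _⊓_ x xs) b) (inctreeF≡treeF n s) (inctreeF≡treeF n t)

dectreeF≡treeF : ∀ n l → dectreeF n l ≡ Dec.treeF n l
dectreeF≡treeF zero l = refl
dectreeF≡treeF (suc n) [] = refl
dectreeF≡treeF (suc n) (x ∷ xs) with splitOn (foldr _⊔_ x xs) (x ∷ xs)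
... | s , t = cong₂ (λ a b → nd a (foldr _⊔_ x xs) b) (dectreeF≡treeF n s) (dectreeF≡treeF n t)

inctree≡tree : ∀ l → inctree l ≡ Inc.tree l
inctree≡tree l = inctreeF≡treeF (length l) l

dectree≡tree : ∀ l → dectree l ≡ Dec.tree l
dectree≡tree l = dectreeF≡treeF (length l) l

map-filterᵇ : ∀ {A B : Set} (f : A → B) (p : B → Bool) xs → map f (filterᵇ (p ∘ f) xs) ≡ filterᵇ p (map f xs)
map-filterᵇ f p [] = refl
map-filterᵇ f p (x ∷ xs) with p (f x)
... | true = cong (f x ∷_) (map-filterᵇ f p xs)
... | false = map-filterᵇ f p xs

filterᵇ-cong : ∀ {A : Set} {p q : A → Bool} → (∀ z → p z ≡ q z) → ∀ xs → filterᵇ p xs ≡ filterᵇ q xs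
filterᵇ-cong {p = p} {q} p≗q = filter-≐ (T? ∘ p) (T? ∘ q) ((λ {z} → subst T (p≗q z)) , (λ {z} → subst T (sym (p≗q z))))

insertAllL : LTree → Word → LTree
insertAllL = foldl (λ t a → insertL a t)

insertAllL-nd : ∀ l a r xs → insertAllL (nd l a r) xs ≡
  nd (insertAllL l (filterᵇ (λ x → not (a ≤ᵇ x)) xs)) a (insertAllL r (filterᵇ (a ≤ᵇ_) xs))
insertAllL-nd l a r [] = refl
insertAllL-nd l a r (x ∷ xs) with a ≤ᵇ x
... | true = insertAllL-nd l a (insertL x r) xs
... | false = insertAllL-nd (insertL x l) a r xs

ltree-∷ : ∀ a xs → ltree (a ∷ xs) ≡ nd (ltree (filterᵇ (λ x → not (a ≤ᵇ x)) xs)) a (ltree (filterᵇ (a ≤ᵇ_) xs))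
ltree-∷ a xs = insertAllL-nd lf a lf xs

insertAllR-nd : ∀ l a r xs → foldr insertR (nd l a r) xs ≡
  nd (foldr insertR l (filterᵇ (_≤ᵇ a) xs)) a (foldr insertR r (filterᵇ (λ x → not (x ≤ᵇ a)) xs))
insertAllR-nd l a r [] = refl
insertAllR-nd l a r (x ∷ xs) rewrite insertAllR-nd l a r xs with x ≤ᵇ a
... | true = refl
... | false = refl

rtree-∷ʳ : ∀ a xs → rtree (xs ++ [ a ]) ≡ nd (rtree (filterᵇ (_≤ᵇ a) xs)) a (rtree (filterᵇ (λ x → not (x ≤ᵇ a)) xs))
rtree-∷ʳ a xs = trans (foldr-++ insertR lf xs [ a ]) (insertAllR-nd lf a lf xs)

≤∧<⇒<ₗₑₓ : ∀ {a b s t} → a ≤ b → s < t → (a , s) <ₗₑₓ (b , t)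
≤∧<⇒<ₗₑₓ a≤b s<t with m≤n⇒m<n∨m≡n a≤b
... | inj₁ a<b = inj₁ a<b
... | inj₂ refl = inj₂ (refl , s<t)

T-not-≤ᵇ : ∀ {a b} → T (not (a ≤ᵇ b)) → b < a
T-not-≤ᵇ = ≤ᵇ-false⇒< ∘ Equivalence.to T-not-≡

length-∷ʳ : ∀ {A : Set} (L : List A) {x} → length (L ++ [ x ]) ≡ suc (length L)
length-∷ʳ L = trans (length-++ L) (+-comm (length L) 1)

tagIncreasing-∷ʳ⁻ : ∀ L z → TagIncreasing (L ++ [ z ]) → TagIncreasing L × All (λ y → proj₂ y < proj₂ z) L
tagIncreasing-∷ʳ⁻ [] z _ = [] , []
tagIncreasing-∷ʳ⁻ (y ∷ L) z (y< ∷ L↑) with tagIncreasing-∷ʳ⁻ L z L↑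
... | L↑′ , L<z = All.++⁻ˡ L y< ∷ L↑′ , All.lookup y< (∈-++⁺ʳ L (here refl)) ∷ L<z

-- ltree inserts from the left and sends ties right: with increasing tags, this is the
-- binary search tree for _<ₗₑₓ_ whose root is the cell of smallest tag.
ltree-isort : ∀ n L → length L ≤ n → TagIncreasing L → ltree (map proj₁ L) ≡ Inc.labelled (Lex.isort L)
ltree-isort n [] _ _ = refl
ltree-isort (suc n) ((a , t) ∷ L) (s≤s len≤) (t<L ∷ L↑) = begin
  ltree (a ∷ map proj₁ L)
    ≡⟨ ltree-∷ a (map proj₁ L) ⟩
  nd (ltree (filterᵇ (λ x → not (a ≤ᵇ x)) (map proj₁ L))) a (ltree (filterᵇ (a ≤ᵇ_) (map proj₁ L)))
    ≡⟨ cong₂ (λ l r → nd (ltree l) a (ltree r)) (sym (map-filterᵇ proj₁ _ L))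
         (sym (trans (cong (map proj₁) (filterᵇ-cong (λ z → not-involutive (a ≤ᵇ proj₁ z)) L)) (map-filterᵇ proj₁ _ L))) ⟩
  nd (ltree (map proj₁ Lˡ)) a (ltree (map proj₁ Lʳ))
    ≡⟨ cong₂ (λ l r → nd l a r) (ltree-isort n Lˡ (part p) (AllPairs.filter⁺ (T? ∘ p) L↑))
                                (ltree-isort n Lʳ (part (not ∘ p)) (AllPairs.filter⁺ (T? ∘ not ∘ p) L↑)) ⟩
  nd (Inc.labelled (Lex.isort Lˡ)) a (Inc.labelled (Lex.isort Lʳ))
    ≡⟨ sym (Inc.labelled-split _ a t _ (tags-above p) (tags-above (not ∘ p))) ⟩
  Inc.labelled (Lex.isort Lˡ ++ (a , t) ∷ Lex.isort Lʳ)
    ≡⟨ cong Inc.labelled (sym (Lex.isort-pivot p (tagIncreasing⇒unique (t<L ∷ L↑)) below above)) ⟩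
  Inc.labelled (Lex.isort ((a , t) ∷ L)) ∎
  where
  p : Cell → Bool
  p z = not (a ≤ᵇ proj₁ z)
  Lˡ = filterᵇ p L
  Lʳ = filterᵇ (not ∘ p) L
  part : ∀ q → length (filterᵇ q L) ≤ n
  part q = ≤-trans (length-filter (T? ∘ q) L) len≤
  tags-above : ∀ q → All ((t <_) ∘ proj₂) (Lex.isort (filterᵇ q L))
  tags-above q = All.tabulate (All.lookup t<L ∘ proj₁ ∘ ∈-filter⁻ (T? ∘ q) ∘ Lex.∈-isort⁻)
  below : ∀ {z} → z ∈ L → T (p z) → z <ₗₑₓ (a , t)
  below _ pz = inj₁ (T-not-≤ᵇ pz)
  above : ∀ {z} → z ∈ L → T (not (p z)) → (a , t) <ₗₑₓ z
  above z∈ ¬pz = ≤∧<⇒<ₗₑₓ (≤ᵇ⇒≤ _ _ (subst T (not-involutive _) ¬pz)) (All.lookup t<L z∈)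

-- rtree inserts from the right and sends ties left: the root is the cell of largest tag.
rtree-isort : ∀ n L → length L ≤ n → TagIncreasing L → rtree (map proj₁ L) ≡ Dec.labelled (Lex.isort L)
rtree-isort n L len≤ L↑ with initLast L
rtree-isort n _ _ _ | [] = refl
rtree-isort zero _ len≤ _ | L ∷ʳ′ (a , t) with () ← subst (_≤ 0) (length-∷ʳ L) len≤
rtree-isort (suc n) _ len≤ L↑′ | L ∷ʳ′ (a , t) = begin
  rtree (map proj₁ (L ++ [ (a , t) ]))
    ≡⟨ cong rtree (map-++ proj₁ L _) ⟩
  rtree (map proj₁ L ++ [ a ])
    ≡⟨ rtree-∷ʳ a (map proj₁ L) ⟩
  nd (rtree (filterᵇ (_≤ᵇ a) (map proj₁ L))) a (rtree (filterᵇ (λ x → not (x ≤ᵇ a)) (map proj₁ L)))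
    ≡⟨ cong₂ (λ l r → nd (rtree l) a (rtree r)) (sym (map-filterᵇ proj₁ _ L)) (sym (map-filterᵇ proj₁ _ L)) ⟩
  nd (rtree (map proj₁ Lˡ)) a (rtree (map proj₁ Lʳ))
    ≡⟨ cong₂ (λ l r → nd l a r) (rtree-isort n Lˡ (part p) (AllPairs.filter⁺ (T? ∘ p) L↑))
                                (rtree-isort n Lʳ (part (not ∘ p)) (AllPairs.filter⁺ (T? ∘ not ∘ p) L↑)) ⟩
  nd (Dec.labelled (Lex.isort Lˡ)) a (Dec.labelled (Lex.isort Lʳ))
    ≡⟨ sym (Dec.labelled-split _ a t _ (tags-below p) (tags-below (not ∘ p))) ⟩
  Dec.labelled (Lex.isort Lˡ ++ (a , t) ∷ Lex.isort Lʳ)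
    ≡⟨ cong Dec.labelled (sym (Lex.isort-pivot p distinct below above)) ⟩
  Dec.labelled (Lex.isort ((a , t) ∷ L))
    ≡⟨ cong Dec.labelled (Lex.isort-↭-cong distinct (tagIncreasing⇒unique L↑′)
                                           (↭-sym (subst (λ l → L ++ [ (a , t) ] ↭ (a , t) ∷ l) (++-identityʳ L) (shift (a , t) L [])))) ⟩
  Dec.labelled (Lex.isort (L ++ [ (a , t) ])) ∎
  where
  L↑ = proj₁ (tagIncreasing-∷ʳ⁻ L (a , t) L↑′)
  L<t = proj₂ (tagIncreasing-∷ʳ⁻ L (a , t) L↑′)
  distinct : AllPairs _≢_ ((a , t) ∷ L)
  distinct = All.map (λ s<t e → <-irrefl (sym (cong proj₂ e)) s<t) L<t ∷ tagIncreasing⇒unique L↑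
  p : Cell → Bool
  p z = proj₁ z ≤ᵇ a
  Lˡ = filterᵇ p L
  Lʳ = filterᵇ (not ∘ p) L
  part : ∀ q → length (filterᵇ q L) ≤ n
  part q = ≤-trans (length-filter (T? ∘ q) L) (s≤s⁻¹ (subst (_≤ suc n) (length-∷ʳ L) len≤))
  tags-below : ∀ q → All ((t >_) ∘ proj₂) (Lex.isort (filterᵇ q L))
  tags-below q = All.tabulate (All.lookup L<t ∘ proj₁ ∘ ∈-filter⁻ (T? ∘ q) ∘ Lex.∈-isort⁻)
  below : ∀ {z} → z ∈ L → T (p z) → z <ₗₑₓ (a , t)
  below z∈ pz = ≤∧<⇒<ₗₑₓ (≤ᵇ⇒≤ _ _ pz) (All.lookup L<t z∈)
  above : ∀ {z} → z ∈ L → T (not (p z)) → (a , t) <ₗₑₓ z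
  above _ ¬pz = inj₁ (T-not-≤ᵇ ¬pz)

ltree-cells : ∀ w → ltree w ≡ fillInorder (Sh (inctree (positions w))) (content w)
ltree-cells w = begin
  ltree w                                   ≡⟨ cong ltree (sym (map-proj₁-indexed 1 w)) ⟩
  ltree (map proj₁ (indexed 1 w))           ≡⟨ ltree-isort _ (indexed 1 w) ≤-refl (indexed-tagIncreasing 1 w) ⟩
  Inc.labelled (cells w)                    ≡⟨ cong (λ τ → fillInorder (Sh τ) (content w)) (sym (inctree≡tree (positions w))) ⟩
  fillInorder (Sh (inctree (positions w))) (content w) ∎

rtree-cells : ∀ w → rtree w ≡ fillInorder (Sh (dectree (positions w))) (content w)
rtree-cells w = begin
  rtree w                                   ≡⟨ cong rtree (sym (map-proj₁-indexed 1 w)) ⟩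
  rtree (map proj₁ (indexed 1 w))           ≡⟨ rtree-isort _ (indexed 1 w) ≤-refl (indexed-tagIncreasing 1 w) ⟩
  Dec.labelled (cells w)                    ≡⟨ cong (λ τ → fillInorder (Sh τ) (content w)) (sym (dectree≡tree (positions w))) ⟩
  fillInorder (Sh (dectree (positions w))) (content w) ∎

nth : ∀ {A : Set} → A → List A → ℕ → A
nth d [] i = d
nth d (x ∷ xs) zero = x
nth d (x ∷ xs) (suc i) = nth d xs i

nth-ext : ∀ {A : Set} (d : A) xs ys → length xs ≡ length ys →
          (∀ i → i < length xs → nth d xs i ≡ nth d ys i) → xs ≡ ys
nth-ext d [] [] _ _ = refl
nth-ext d (x ∷ xs) (y ∷ ys) e f =
  cong₂ _∷_ (f 0 (s≤s z≤n)) (nth-ext d xs ys (suc-injective e) (λ i i< → f (suc i) (s≤s i<)))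

nth-map : ∀ {A B : Set} (d : A) (d′ : B) (f : A → B) xs i → i < length xs → nth d′ (map f xs) i ≡ f (nth d xs i)
nth-map d d′ f (x ∷ xs) zero _ = refl
nth-map d d′ f (x ∷ xs) (suc i) (s≤s i<) = nth-map d d′ f xs i i<

nth-applyUpTo : ∀ {A : Set} (d : A) (g : ℕ → A) n i → i < n → nth d (applyUpTo g n) i ≡ g i
nth-applyUpTo d g (suc n) zero _ = refl
nth-applyUpTo d g (suc n) (suc i) (s≤s i<) = nth-applyUpTo d (λ k → g (suc k)) n i i<

nth-∈ : ∀ {A : Set} (d : A) xs i → i < length xs → nth d xs i ∈ xs
nth-∈ d (x ∷ xs) zero _ = here refl
nth-∈ d (x ∷ xs) (suc i) (s≤s i<) = there (nth-∈ d xs i i<)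

∈-nth : ∀ {A : Set} (d : A) {x} xs → x ∈ xs → ∃ λ i → i < length xs × nth d xs i ≡ x
∈-nth d (y ∷ xs) (here refl) = 0 , s≤s z≤n , refl
∈-nth d (y ∷ xs) (there x∈) with ∈-nth d xs x∈
... | i , i< , e = suc i , s≤s i< , e

∈-indexed-nth : ∀ n u {z} → z ∈ indexed n u → ∃ λ p → p < length u × z ≡ (nth 0 u p , n + p)
∈-indexed-nth n (x ∷ u) (here refl) = 0 , s≤s z≤n , cong (x ,_) (sym (+-identityʳ n))
∈-indexed-nth n (x ∷ u) (there z∈) with ∈-indexed-nth (suc n) u z∈
... | p , p< , e = suc p , s≤s p< , trans e (cong (nth 0 u p ,_) (sym (+-suc n p)))

nth-∈-indexed : ∀ n u p → p < length u → (nth 0 u p , n + p) ∈ indexed n u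
nth-∈-indexed n (x ∷ u) zero _ rewrite +-identityʳ n = here refl
nth-∈-indexed n (x ∷ u) (suc p) (s≤s p<) rewrite +-suc n p = there (nth-∈-indexed (suc n) u p p<)

_<ₗₑₓᵇ_ : Cell → Cell → Bool
(b , s) <ₗₑₓᵇ (a , t) = (b <ᵇ a) ∨ ((b ≡ᵇ a) ∧ (s <ᵇ t))

<ₗₑₓᵇ⇒<ₗₑₓ : ∀ x y → (x <ₗₑₓᵇ y) ≡ true → x <ₗₑₓ y
<ₗₑₓᵇ⇒<ₗₑₓ (b , s) (a , t) e with b <ᵇ a in e₁
... | true = inj₁ (<ᵇ⇒<′ e₁)
... | false with b ≡ᵇ a in e₂
...   | true = inj₂ (≡ᵇ⇒≡′ e₂ , <ᵇ⇒<′ e)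

<ₗₑₓ⇒<ₗₑₓᵇ : ∀ {x y} → x <ₗₑₓ y → (x <ₗₑₓᵇ y) ≡ true
<ₗₑₓ⇒<ₗₑₓᵇ (inj₁ b<a) rewrite <⇒<ᵇ′ b<a = refl
<ₗₑₓ⇒<ₗₑₓᵇ {b , _} (inj₂ (refl , s<t)) rewrite ≤⇒<ᵇ-false (≤-refl {b}) | ≡ᵇ-refl b | <⇒<ᵇ′ s<t = refl

≮ₗₑₓ⇒<ₗₑₓᵇ-false : ∀ {x y} → ¬ (x <ₗₑₓ y) → (x <ₗₑₓᵇ y) ≡ false
≮ₗₑₓ⇒<ₗₑₓᵇ-false {x} {y} x≮y with x <ₗₑₓᵇ y in e
... | true = ⊥-elim (x≮y (<ₗₑₓᵇ⇒<ₗₑₓ x y e))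
... | false = refl

rank : Cell → List Cell → ℕ
rank z = count (_<ₗₑₓᵇ z)

rank-nth : ∀ zs j → AllPairs _<ₗₑₓ_ zs → j < length zs → rank (nth (0 , 0) zs j) zs ≡ j
rank-nth (z ∷ zs) zero (z< ∷ _) _ =
  cong₂ _+_ (cong ind (≮ₗₑₓ⇒<ₗₑₓᵇ-false {z} {z} Lex.≺-irrefl)) (count-none zs (All.map (λ {y} z<y → ≮ₗₑₓ⇒<ₗₑₓᵇ-false {y} {z} (Lex.≺-asym z<y)) z<))
  where
  count-none : ∀ ys → All (λ y → (y <ₗₑₓᵇ z) ≡ false) ys → count (_<ₗₑₓᵇ z) ys ≡ 0
  count-none [] [] = refl
  count-none (y ∷ ys) (e ∷ es) = cong₂ _+_ (cong ind e) (count-none ys es)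
rank-nth (z ∷ zs) (suc j) (z< ∷ zs↑) (s≤s j<) =
  cong₂ _+_ (cong ind (<ₗₑₓ⇒<ₗₑₓᵇ (All.lookup z< (nth-∈ _ zs j j<)))) (rank-nth zs j zs↑ j<)

nth-rank : ∀ {zs z} → AllPairs _<ₗₑₓ_ zs → z ∈ zs → nth (0 , 0) zs (rank z zs) ≡ z
nth-rank {zs} zs↑ z∈ with ∈-nth (0 , 0) zs z∈
... | j , j< , refl = cong (nth (0 , 0) zs) (rank-nth zs j zs↑ j<)

countLt-indexed : ∀ n u a m → m ≤ n → count (_<ₗₑₓᵇ (a , m)) (indexed n u) ≡ countLt a u
countLt-indexed n [] a m _ = refl
countLt-indexed n (x ∷ u) a m m≤n rewrite ≤⇒<ᵇ-false m≤n | ∧-zeroʳ (x ≡ᵇ a) | ∨-identityʳ (x <ᵇ a) =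
  cong (ind (x <ᵇ a) +_) (countLt-indexed (suc n) u a m (m≤n⇒m≤1+n m≤n))

rank-indexed : ∀ n u a p t → t ≡ n + p →
               countLt a u + countEq a (take p u) ≡ count (_<ₗₑₓᵇ (a , t)) (indexed n u)
rank-indexed n [] a zero t _ = refl
rank-indexed n [] a (suc p) t _ = refl
rank-indexed n (x ∷ u) a zero t e =
  trans (+-identityʳ _) (sym (countLt-indexed n (x ∷ u) a t (≤-reflexive (trans e (+-identityʳ n)))))
rank-indexed n (x ∷ u) a (suc p) t e
  rewrite <⇒<ᵇ′ {n} {t} (subst (n <_) (sym (trans e (+-suc n p))) (s≤s (m≤m+n n p)))
        | ∧-identityʳ (x ≡ᵇ a)
        | sym (rank-indexed (suc n) u a p t (trans e (+-suc n p)))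
  with x <ᵇ a in e₁ | x ≡ᵇ a in e₂
... | true | true = ⊥-elim (<-irrefl (≡ᵇ⇒≡′ {x} {a} e₂) (<ᵇ⇒<′ e₁))
... | true | false = refl
... | false | true = +-suc (countLt a u) _
... | false | false = refl

length-std : ∀ u → length (std u) ≡ length u
length-std u = trans (length-stdPairs (zip (upTo (length u)) u)) (length-zip-applyUpTo (λ k → k) (length u) u ≤-refl)
  where
  length-stdPairs : ∀ ps → length (stdPairs u ps) ≡ length ps
  length-stdPairs [] = refl
  length-stdPairs (p ∷ ps) = cong suc (length-stdPairs ps)
  length-zip-applyUpTo : ∀ (g : ℕ → ℕ) m (xs : List ℕ) → length xs ≤ m → length (zip (applyUpTo g m) xs) ≡ length xs
  length-zip-applyUpTo g zero [] _ = refl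
  length-zip-applyUpTo g (suc m) [] _ = refl
  length-zip-applyUpTo g (suc m) (x ∷ xs) (s≤s len≤) = cong suc (length-zip-applyUpTo (λ k → g (suc k)) m xs len≤)

nth-std : ∀ u p → p < length u → nth 0 (std u) p ≡ stdAt u p (nth 0 u p)
nth-std u p p< = go (λ k → k) (length u) u p p< ≤-refl
  where
  go : ∀ (g : ℕ → ℕ) m xs p → p < length xs → length xs ≤ m →
       nth 0 (stdPairs u (zip (applyUpTo g m) xs)) p ≡ stdAt u (g p) (nth 0 xs p)
  go g (suc m) (x ∷ xs) zero _ _ = refl
  go g (suc m) (x ∷ xs) (suc p) (s≤s p<) (s≤s len≤) = go (λ k → g (suc k)) m xs p p< len≤

std-rank : ∀ u p → p < length u → nth 0 (std u) p ≡ suc (rank (nth 0 u p , suc p) (cells u))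
std-rank u p p< = trans (nth-std u p p<)
  (cong suc (trans (rank-indexed 1 u (nth 0 u p) p (suc p) refl) (sym (count-↭ _ (cells-↭ u)))))

std-injective : ∀ u {p p′} → p < length u → p′ < length u → nth 0 (std u) p ≡ nth 0 (std u) p′ → p ≡ p′
std-injective u {p} {p′} p< p′< e = suc-injective (cong proj₂ (begin
  (nth 0 u p , suc p)                                    ≡⟨ sym (nth-rank (cells-sorted u) (cell∈ p p<)) ⟩
  nth (0 , 0) (cells u) (rank (nth 0 u p , suc p) (cells u))   ≡⟨ cong (nth (0 , 0) (cells u)) same-rank ⟩
  nth (0 , 0) (cells u) (rank (nth 0 u p′ , suc p′) (cells u)) ≡⟨ nth-rank (cells-sorted u) (cell∈ p′ p′<) ⟩
  (nth 0 u p′ , suc p′)                                  ∎))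
  where
  cell∈ : ∀ q → q < length u → (nth 0 u q , suc q) ∈ cells u
  cell∈ q q< = ∈-cells⁺ (nth-∈-indexed 1 u q q<)
  same-rank : rank (nth 0 u p , suc p) (cells u) ≡ rank (nth 0 u p′ , suc p′) (cells u)
  same-rank = suc-injective (trans (sym (std-rank u p p<)) (trans e (std-rank u p′ p′<)))

indexOf-first : ∀ l p v → p < length l → nth 0 l p ≡ v → (∀ p′ → p′ < p → nth 0 l p′ ≢ v) → indexOf v l ≡ suc p
indexOf-first (x ∷ l) zero v _ refl _ rewrite ≡ᵇ-refl x = refl
indexOf-first (x ∷ l) (suc p) v (s≤s p<) e earlier rewrite ≢⇒≡ᵇ-false (earlier 0 (s≤s z≤n)) =
  cong suc (indexOf-first l p v p< e (λ p′ p′< → earlier (suc p′) (s≤s p′<)))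

length-invPerm : ∀ w → length (invPerm w) ≡ length w
length-invPerm w = trans (length-map _ (applyUpTo suc (length w))) (length-applyUpTo suc (length w))

nth-invPerm : ∀ w j → j < length w → nth 0 (invPerm w) j ≡ indexOf (suc j) w
nth-invPerm w j j< = trans
  (nth-map 0 0 (λ j → indexOf j w) (applyUpTo suc (length w)) j (subst (j <_) (sym (length-applyUpTo suc (length w))) j<))
  (cong (λ v → indexOf v w) (nth-applyUpTo 0 suc (length w) j j<))

invPerm-std : ∀ u → invPerm (std u) ≡ positions u
invPerm-std u = nth-ext 0 _ _ (trans (length-invPerm (std u)) (trans (length-std u) (sym (length-positions u)))) pointwise
  where
  cells-bound : ∀ {j} → j < length (invPerm (std u)) → j < length (cells u)
  cells-bound = subst (_ <_) (trans (length-invPerm (std u)) (trans (length-std u) (sym (length-cells u))))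
  pointwise : ∀ j → j < length (invPerm (std u)) → nth 0 (invPerm (std u)) j ≡ nth 0 (positions u) j
  pointwise j j<′ with ∈-indexed-nth 1 u (∈-cells⁻ (nth-∈ (0 , 0) (cells u) j (cells-bound j<′)))
  ... | p , p< , cellⱼ = begin
    nth 0 (invPerm (std u)) j  ≡⟨ nth-invPerm (std u) j j<ˢ ⟩
    indexOf (suc j) (std u)    ≡⟨ indexOf-first (std u) p (suc j) (subst (p <_) (sym (length-std u)) p<) std-p earlier ⟩
    suc p                      ≡⟨ sym (trans (nth-map (0 , 0) 0 proj₂ (cells u) j j<ᶜ) (cong proj₂ cellⱼ)) ⟩
    nth 0 (positions u) j      ∎
    where
    j<ˢ = subst (j <_) (length-invPerm (std u)) j<′
    j<ᶜ = cells-bound j<′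
    std-p : nth 0 (std u) p ≡ suc j
    std-p = trans (std-rank u p p<) (cong suc (trans (cong (λ z → rank z (cells u)) (sym cellⱼ)) (rank-nth (cells u) j (cells-sorted u) j<ᶜ)))
    earlier : ∀ p′ → p′ < p → nth 0 (std u) p′ ≢ suc j
    earlier p′ p′<p e = <-irrefl (std-injective u (<-trans p′<p p<) p< (trans e (sym std-p))) p′<p

elemᵇ⇒∈ : ∀ a xs → elemᵇ a xs ≡ true → a ∈ xs
elemᵇ⇒∈ a (x ∷ xs) e with x ≡ᵇ a in eq
... | true = here (sym (≡ᵇ⇒≡′ eq))
... | false = there (elemᵇ⇒∈ a xs e)

∈⇒elemᵇ : ∀ a xs → a ∈ xs → elemᵇ a xs ≡ true
∈⇒elemᵇ a (x ∷ xs) (here refl) rewrite ≡ᵇ-refl a = refl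
∈⇒elemᵇ a (x ∷ xs) (there a∈) rewrite ∈⇒elemᵇ a xs a∈ with x ≡ᵇ a
... | true = refl
... | false = refl

replLeft-just⁻ : ∀ a b l l′ → replLeft a b l ≡ just l′ → ∃₂ λ P Q → l ≡ P ++ a ∷ Q × a ∉ P × l′ ≡ P ++ b ∷ Q
replLeft-just⁻ a b (x ∷ xs) l′ e with x ≡ᵇ a in eq
replLeft-just⁻ a b (x ∷ xs) l′ refl | true = [] , xs , cong (_∷ xs) (≡ᵇ⇒≡′ eq) , (λ ()) , refl
replLeft-just⁻ a b (x ∷ xs) l′ e | false with replLeft a b xs in e₂
replLeft-just⁻ a b (x ∷ xs) l′ refl | false | just r with replLeft-just⁻ a b xs r e₂
... | P , Q , refl , a∉P , refl =
  x ∷ P , Q , refl , (λ { (here e′) → ≡ᵇ-false⇒≢ eq (sym e′) ; (there a∈P) → a∉P a∈P }) , refl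

replLeft-∈ : ∀ a b l → a ∈ l → ∃₂ λ P Q → l ≡ P ++ a ∷ Q × a ∉ P × replLeft a b l ≡ just (P ++ b ∷ Q)
replLeft-∈ a b (x ∷ xs) a∈ with x ≡ᵇ a in eq
... | true = [] , xs , cong (_∷ xs) (≡ᵇ⇒≡′ eq) , (λ ()) , refl
... | false with a∈
...   | here e = ⊥-elim (≡ᵇ-false⇒≢ eq (sym e))
...   | there a∈xs with replLeft-∈ a b xs a∈xs
...     | P , Q , refl , a∉P , e rewrite e =
          x ∷ P , Q , refl , (λ { (here e′) → ≡ᵇ-false⇒≢ eq (sym e′) ; (there a∈P) → a∉P a∈P }) , refl

reverse-mid : ∀ {A : Set} (P : List A) (x : A) Q → reverse (P ++ x ∷ Q) ≡ reverse Q ++ x ∷ reverse P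
reverse-mid P x Q = trans (reverse-++ P (x ∷ Q)) (trans (cong (_++ reverse P) (unfold-reverse x Q)) (++-assoc (reverse Q) [ x ] (reverse P)))

qf-just⁻ : ∀ i x y → qf i x ≡ just y →
           blocked i x ≡ false × ∃₂ λ P Q → x ≡ P ++ i ∷ Q × i ∉ Q × y ≡ P ++ suc i ∷ Q
qf-just⁻ i x y e with blocked i x
... | false with replLeft i (suc i) (reverse x) in e₂
qf-just⁻ i x y refl | false | just r with replLeft-just⁻ i (suc i) (reverse x) r e₂
... | P , Q , eq , i∉P , refl = refl , reverse Q , reverse P ,
      trans (sym (reverse-involutive x)) (trans (cong reverse eq) (reverse-mid P i Q)) ,
      i∉P ∘ ∈-resp-↭ (↭-reverse P) , reverse-mid P (suc i) Q

qf-defined : ∀ i x → blocked i x ≡ false → i ∈ x →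
             ∃₂ λ P Q → x ≡ P ++ i ∷ Q × i ∉ Q × qf i x ≡ just (P ++ suc i ∷ Q)
qf-defined i x unblocked i∈x with replLeft-∈ i (suc i) (reverse x) (∈-resp-↭ (↭-sym (↭-reverse x)) i∈x)
... | P , Q , eq , i∉P , e = reverse Q , reverse P ,
      trans (sym (reverse-involutive x)) (trans (cong reverse eq) (reverse-mid P i Q)) ,
      i∉P ∘ ∈-resp-↭ (↭-reverse P) , result
  where
  result : qf i x ≡ just (reverse Q ++ suc i ∷ reverse P)
  result rewrite unblocked | e = cong just (reverse-mid P (suc i) Q)

∷-last-unique : ∀ {A : Set} {i : A} P Q P′ Q′ → P ++ i ∷ Q ≡ P′ ++ i ∷ Q′ → i ∉ Q → i ∉ Q′ → P ≡ P′ × Q ≡ Q′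
∷-last-unique [] Q [] Q′ refl _ _ = refl , refl
∷-last-unique [] Q (x ∷ P′) Q′ refl i∉Q _ = ⊥-elim (i∉Q (∈-++⁺ʳ P′ (here refl)))
∷-last-unique (x ∷ P) Q [] Q′ refl _ i∉Q′ = ⊥-elim (i∉Q′ (∈-++⁺ʳ P (here refl)))
∷-last-unique (x ∷ P) Q (y ∷ P′) Q′ e i∉Q i∉Q′ with ∷-injective e
... | refl , e′ with ∷-last-unique P Q P′ Q′ e′ i∉Q i∉Q′
...   | refl , refl = refl , refl

Inverted : ℕ → List Cell → Set
Inverted i zs = ∃₂ λ p q → (suc i , p) ∈ zs × (i , q) ∈ zs × p < q

Inverted-resp-↭ : ∀ i {zs zs′} → zs ↭ zs′ → Inverted i zs → Inverted i zs′
Inverted-resp-↭ i zs↭ (p , q , m₁ , m₂ , p<q) = p , q , ∈-resp-↭ zs↭ m₁ , ∈-resp-↭ zs↭ m₂ , p<q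

blocked⇒inverted : ∀ i n x → blocked i x ≡ true → Inverted i (indexed n x)
blocked⇒inverted i n (y ∷ ys) e with y ≡ᵇ suc i in eq
... | true with ∈-indexed⁺ (suc n) ys (elemᵇ⇒∈ i ys e)
...   | q , m = n , q , subst (λ a → (a , n) ∈ indexed n (y ∷ ys)) (≡ᵇ⇒≡′ eq) (here refl) , there m , indexed-tag≥ (suc n) ys m
blocked⇒inverted i n (y ∷ ys) e | false with blocked⇒inverted i (suc n) ys e
... | p , q , m₁ , m₂ , p<q = p , q , there m₁ , there m₂ , p<q

inverted⇒blocked : ∀ i n x → Inverted i (indexed n x) → blocked i x ≡ true
inverted⇒blocked i n (y ∷ ys) (p , q , m₁ , m₂ , p<q) with y ≡ᵇ suc i in eq
inverted⇒blocked i n (y ∷ ys) (p , q , m₁ , here refl , p<q) | true = ⊥-elim (<-irrefl (≡ᵇ⇒≡′ eq) (n<1+n i))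
inverted⇒blocked i n (y ∷ ys) (p , q , m₁ , there m₂ , p<q) | true = ∈⇒elemᵇ i ys (∈-indexed⁻ (suc n) ys m₂)
inverted⇒blocked i n (y ∷ ys) (p , q , here refl , m₂ , p<q) | false = ⊥-elim (≡ᵇ-false⇒≢ {suc i} eq refl)
inverted⇒blocked i n (y ∷ ys) (p , q , there m₁ , here refl , p<q) | false =
  ⊥-elim (<-asym p<q (<-≤-trans (n<1+n n) (indexed-tag≥ (suc n) ys m₁)))
inverted⇒blocked i n (y ∷ ys) (p , q , there m₁ , there m₂ , p<q) | false = inverted⇒blocked i (suc n) ys (p , q , m₁ , m₂ , p<q)

blocked⇒inverted-cells : ∀ i x → blocked i x ≡ true → Inverted i (cells x)
blocked⇒inverted-cells i x = Inverted-resp-↭ i (↭-sym (cells-↭ x)) ∘ blocked⇒inverted i 1 x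

inverted-cells⇒blocked : ∀ i x → Inverted i (cells x) → blocked i x ≡ true
inverted-cells⇒blocked i x = inverted⇒blocked i 1 x ∘ Inverted-resp-↭ i (cells-↭ x)

replace-mid-↭ : ∀ {A : Set} {v v′ : A} P Q P′ Q′ → P ++ v ∷ Q ↭ P′ ++ v ∷ Q′ → P ++ v′ ∷ Q ↭ P′ ++ v′ ∷ Q′
replace-mid-↭ {v′ = v′} P Q P′ Q′ r = ↭-trans (shift v′ P Q) (↭-trans (↭.prep v′ (drop-mid P P′ r)) (↭-sym (shift v′ P′ Q′)))

mid-cell∈ : ∀ A i B → (i , suc (length A)) ∈ cells (A ++ i ∷ B)
mid-cell∈ A i B = ∈-cells⁺ (subst (_ ∈_) (sym (indexed-++ 1 A (i ∷ B))) (∈-++⁺ʳ (indexed 1 A) (here refl)))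

-- the rightmost i is followed by no i, and preceded by no i+1 unless f̈ᵢ is blocked
raised-below : ∀ i A B → i ∉ B → blocked i (A ++ i ∷ B) ≡ false → ∀ {b s} → (b , s) ∈ cells (A ++ i ∷ B) →
               (i , suc (length A)) <ₗₑₓ (b , s) → (suc i , suc (length A)) <ₗₑₓ (b , s)
raised-below i A B i∉B unblocked {b} {s} z∈ c<z with c<z
... | inj₂ (refl , q<s) = ⊥-elim (i∉B (in-B (subst ((i , s) ∈_) (indexed-++ 1 A (i ∷ B)) (∈-cells⁻ z∈))))
  where
  in-B : (i , s) ∈ indexed 1 A ++ (i , suc (length A)) ∷ indexed (suc (suc (length A))) B → i ∈ B
  in-B m with ∈-++⁻ (indexed 1 A) m
  ... | inj₁ mA = ⊥-elim (<-asym q<s (indexed-tag< 1 A mA))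
  ... | inj₂ (here refl) = ⊥-elim (<-irrefl refl q<s)
  ... | inj₂ (there mB) = ∈-indexed⁻ _ B mB
... | inj₁ i<b with m≤n⇒m<n∨m≡n i<b
...   | inj₁ si<b = inj₁ si<b
...   | inj₂ refl with <-cmp (suc (length A)) s
...     | tri< q<s _ _ = inj₂ (refl , q<s)
...     | tri≈ _ refl _ = ⊥-elim (<-irrefl (cells-tag-unique (A ++ i ∷ B) (mid-cell∈ A i B) z∈) (n<1+n i))
...     | tri> _ _ s<q = ⊥-elim (true≢false (trans (sym (inverted-cells⇒blocked i (A ++ i ∷ B) (s , suc (length A) , z∈ , mid-cell∈ A i B , s<q))) unblocked))
  where
  true≢false : true ≡ false → ⊥
  true≢false ()

qf-cells : ∀ i x y → qf i x ≡ just y → ∃ λ q → ∃₂ λ P Q →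
           cells x ≡ P ++ (i , q) ∷ Q × cells y ≡ P ++ (suc i , q) ∷ Q × All ((suc i , q) <ₗₑₓ_) Q
qf-cells i x y e with qf-just⁻ i x y e
... | unblocked , A , B , refl , i∉B , refl with ∈-∃++ (mid-cell∈ A i B)
... | P , Q , cellsˣ = q , P , Q , cellsˣ , cellsʸ , raised<Q
  where
  q = suc (length A)
  split = Lex.sorted-split P (subst (AllPairs _<ₗₑₓ_) cellsˣ (cells-sorted x))
  raised<Q : All ((suc i , q) <ₗₑₓ_) Q
  raised<Q = All.tabulate (λ { {b , s} z∈ → raised-below i A B i∉B unblocked
    (subst (_ ∈_) (sym cellsˣ) (∈-++⁺ʳ P (there z∈))) (All.lookup (proj₁ (proj₂ (proj₂ split))) z∈) })
  raised-sorted : AllPairs _<ₗₑₓ_ (P ++ (suc i , q) ∷ Q)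
  raised-sorted = Lex.++-sorted (proj₁ split) (All.map (λ z<c → <ₗₑₓ-trans z<c (inj₁ (n<1+n i))) (proj₁ (proj₂ split)))
                                raised<Q (proj₂ (proj₂ (proj₂ split)))
  raised-↭ : indexed 1 (A ++ suc i ∷ B) ↭ P ++ (suc i , q) ∷ Q
  raised-↭ = subst₂ _↭_ (sym (indexed-++ 1 A (suc i ∷ B))) refl
    (replace-mid-↭ (indexed 1 A) (indexed (suc q) B) P Q
      (subst₂ _↭_ (indexed-++ 1 A (i ∷ B)) cellsˣ (↭-sym (cells-↭ x))))
  cellsʸ : cells (A ++ suc i ∷ B) ≡ P ++ (suc i , q) ∷ Q
  cellsʸ = Lex.sorted-unique (cells-sorted (A ++ suc i ∷ B)) raised-sorted
    (∈-resp-↭ raised-↭ ∘ ∈-cells⁻) (∈-cells⁺ ∘ ∈-resp-↭ (↭-sym raised-↭))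

qf-positions : ∀ i x y → qf i x ≡ just y → positions y ≡ positions x
qf-positions i x y e with qf-cells i x y e
... | q , P , Q , cellsˣ , cellsʸ , _ = begin
  map proj₂ (cells y)                   ≡⟨ cong (map proj₂) cellsʸ ⟩
  map proj₂ (P ++ (suc i , q) ∷ Q)      ≡⟨ map-++ proj₂ P _ ⟩
  map proj₂ P ++ q ∷ map proj₂ Q        ≡⟨ sym (map-++ proj₂ P _) ⟩
  map proj₂ (P ++ (i , q) ∷ Q)          ≡⟨ cong (map proj₂) (sym cellsˣ) ⟩
  map proj₂ (cells x)                   ∎

qf-content : ∀ i x y → qf i x ≡ just y →
             ∃₂ λ P Q → content x ≡ P ++ i ∷ Q × i ∉ Q × content y ≡ P ++ suc i ∷ Q
qf-content i x y e with qf-cells i x y e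
... | q , P , Q , cellsˣ , cellsʸ , raised<Q =
  map proj₁ P , map proj₁ Q ,
  trans (cong (map proj₁) cellsˣ) (map-++ proj₁ P _) , i∉Q ,
  trans (cong (map proj₁) cellsʸ) (map-++ proj₁ P _)
  where
  i∉Q : i ∉ map proj₁ Q
  i∉Q i∈ with ∈-map⁻ proj₁ i∈
  ... | (b , s) , z∈ , refl with All.lookup raised<Q z∈
  ...   | inj₁ si<b = <-asym si<b (n<1+n b)
  ...   | inj₂ (e′ , _) = <-irrefl (sym e′) (n<1+n b)

AdjacentInversion : ℕ → List ℕ → List ℕ → Set
AdjacentInversion i c π = ∃ λ r → suc r < length c × nth 0 c r ≡ i × nth 0 c (suc r) ≡ suc i × nth 0 π (suc r) < nth 0 π r

inverted⇒adjacent : ∀ i zs {p q} → AllPairs _<ₗₑₓ_ zs → (suc i , p) ∈ zs → (i , q) ∈ zs → p < q →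
                    AdjacentInversion i (map proj₁ zs) (map proj₂ zs)
inverted⇒adjacent i (z ∷ zs) (z< ∷ _) (here refl) (there m₂) p<q with All.lookup z< m₂
... | inj₁ si<i = ⊥-elim (<-asym si<i (n<1+n i))
... | inj₂ (e , _) = ⊥-elim (<-irrefl (sym e) (n<1+n i))
inverted⇒adjacent i (z ∷ zs) (_ ∷ zs↑) (there m₁) (there m₂) p<q with inverted⇒adjacent i zs zs↑ m₁ m₂ p<q
... | r , r< , e₁ , e₂ , π< = suc r , s≤s r< , e₁ , e₂ , π<
inverted⇒adjacent i (z ∷ (b , s) ∷ zs) (z< ∷ zs↑) (there m₁) (here refl) p<q with All.lookup z< (here refl)
... | inj₂ (refl , q<s) with inverted⇒adjacent i ((b , s) ∷ zs) zs↑ m₁ (here refl) (<-trans p<q q<s)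
...   | r , r< , e₁ , e₂ , π< = suc r , s≤s r< , e₁ , e₂ , π<
inverted⇒adjacent i (z ∷ (b , s) ∷ zs) (z< ∷ zs↑) (there (here refl)) (here refl) p<q | inj₁ _ =
  0 , s≤s (s≤s z≤n) , refl , refl , p<q
inverted⇒adjacent i (z ∷ (b , s) ∷ zs) (z< ∷ (b< ∷ _)) (there (there m₁)) (here refl) p<q | inj₁ i<b
  with All.lookup b< m₁
... | inj₁ b<si = ⊥-elim (<-irrefl refl (<-≤-trans i<b (s≤s⁻¹ b<si)))
... | inj₂ (refl , s<p) = 0 , s≤s (s≤s z≤n) , refl , refl , <-trans s<p p<q

adjacent⇒inverted : ∀ i zs → AdjacentInversion i (map proj₁ zs) (map proj₂ zs) → Inverted i zs
adjacent⇒inverted i zs (r , r<′ , e₁ , e₂ , π<) =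
  proj₂ (nth d zs (suc r)) , proj₂ (nth d zs r) ,
  subst (λ a → (a , proj₂ (nth d zs (suc r))) ∈ zs) (trans (sym (nth-map d 0 proj₁ zs (suc r) r<)) e₂) (nth-∈ d zs (suc r) r<) ,
  subst (λ a → (a , proj₂ (nth d zs r)) ∈ zs) (trans (sym (nth-map d 0 proj₁ zs r r<₀)) e₁) (nth-∈ d zs r r<₀) ,
  subst₂ _<_ (nth-map d 0 proj₂ zs (suc r) r<) (nth-map d 0 proj₂ zs r r<₀) π<
  where
  d = (0 , 0)
  r< = subst (suc r <_) (length-map proj₁ zs) r<′
  r<₀ = <-trans (n<1+n r) r<

blocked⇒adjacent : ∀ i x → blocked i x ≡ true → AdjacentInversion i (content x) (positions x)
blocked⇒adjacent i x e with blocked⇒inverted-cells i x e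
... | p , q , m₁ , m₂ , p<q = inverted⇒adjacent i (cells x) (cells-sorted x) m₁ m₂ p<q

adjacent⇒blocked : ∀ i x → AdjacentInversion i (content x) (positions x) → blocked i x ≡ true
adjacent⇒blocked i x = inverted-cells⇒blocked i x ∘ adjacent⇒inverted i (cells x)

-- Descents of a permutation are read off the shape of its increasing tree

-- entry r records whether π(r+1) < π(r); the final entry is true, matching the empty right
-- subtree of the last node in rightLeafFlags
descents : List ℕ → List Bool
descents [] = []
descents (x ∷ []) = true ∷ []
descents (x ∷ y ∷ ys) = (y <ᵇ x) ∷ descents (y ∷ ys)

isLeaf : BTree → Bool
isLeaf leaf = true
isLeaf (node _ _) = false

rightLeafFlags : BTree → List Bool
rightLeafFlags leaf = []
rightLeafFlags (node l r) = rightLeafFlags l ++ isLeaf r ∷ rightLeafFlags r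

descents-++ : ∀ l₁ m l₂ → All (m <_) l₁ → descents (l₁ ++ m ∷ l₂) ≡ descents l₁ ++ descents (m ∷ l₂)
descents-++ [] m l₂ _ = refl
descents-++ (x ∷ []) m l₂ (m<x ∷ []) rewrite <⇒<ᵇ′ m<x = refl
descents-++ (x ∷ y ∷ l₁) m l₂ (_ ∷ m<) = cong ((y <ᵇ x) ∷_) (descents-++ (y ∷ l₁) m l₂ m<)

descents-∷ : ∀ m l → All (m <_) l → descents (m ∷ l) ≡ isLeaf (Sh (inctree l)) ∷ descents l
descents-∷ m [] _ = refl
descents-∷ m (y ∷ ys) (m<y ∷ _) rewrite ≤⇒<ᵇ-false {y} {m} (<⇒≤ m<y) = refl

fold-⊓-≤ : ∀ x xs {e} → e ∈ x ∷ xs → foldr _⊓_ x xs ≤ e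
fold-⊓-≤ x [] (here refl) = ≤-refl
fold-⊓-≤ x (y ∷ ys) (here refl) = ≤-trans (m⊓n≤n y _) (fold-⊓-≤ x ys (here refl))
fold-⊓-≤ x (y ∷ ys) (there (here refl)) = m⊓n≤m y _
fold-⊓-≤ x (y ∷ ys) (there (there e∈)) = ≤-trans (m⊓n≤n y _) (fold-⊓-≤ x ys (there e∈))

unique-++⁻ : ∀ {A : Set} (l₁ : List A) {m l₂} → AllPairs _≢_ (l₁ ++ m ∷ l₂) → m ∉ l₁ × m ∉ l₂ × AllPairs _≢_ l₁ × AllPairs _≢_ l₂
unique-++⁻ [] (m≢ ∷ l₂!) = (λ ()) , All.All¬⇒¬Any m≢ , [] , l₂!
unique-++⁻ (x ∷ l₁) (x≢ ∷ rest!) with unique-++⁻ l₁ rest!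
... | m∉l₁ , m∉l₂ , l₁! , l₂! =
  (λ { (here refl) → All.lookup x≢ (∈-++⁺ʳ l₁ (here refl)) refl ; (there m∈) → m∉l₁ m∈ }) ,
  m∉l₂ , All.++⁻ˡ l₁ x≢ ∷ l₁! , l₂!

descents-inctreeF : ∀ n t → length t ≤ n → AllPairs _≢_ t → descents t ≡ rightLeafFlags (Sh (inctree t))
descents-inctreeF n [] _ _ = refl
descents-inctreeF (suc n) (x ∷ xs) (s≤s len≤) t! = subst (λ l → descents l ≡ rightLeafFlags (Sh (inctree l))) (sym t≡) (begin
  descents (l₁ ++ m ∷ l₂)                                          ≡⟨ descents-++ l₁ m l₂ m<l₁ ⟩
  descents l₁ ++ descents (m ∷ l₂)                                 ≡⟨ cong (descents l₁ ++_) (descents-∷ m l₂ m<l₂) ⟩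
  descents l₁ ++ isLeaf (Sh (inctree l₂)) ∷ descents l₂            ≡⟨ cong₂ (λ a b → a ++ isLeaf (Sh (inctree l₂)) ∷ b) (descents-inctreeF n l₁ l₁≤ l₁!) (descents-inctreeF n l₂ l₂≤ l₂!) ⟩
  rightLeafFlags (Sh (nd (inctree l₁) m (inctree l₂)))             ≡⟨ cong (rightLeafFlags ∘ Sh) (sym inctree-split) ⟩
  rightLeafFlags (Sh (inctree (l₁ ++ m ∷ l₂)))                     ∎)
  where
  m : ℕ
  m = foldr _⊓_ x xs
  l₁ l₂ : List ℕ
  l₁ = proj₁ (splitOn m (x ∷ xs))
  l₂ = proj₂ (splitOn m (x ∷ xs))
  t≡ : x ∷ xs ≡ l₁ ++ m ∷ l₂
  t≡ = splitOn-∈ m (x ∷ xs) (Inc.fold-∈ x xs)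
  parts = unique-++⁻ l₁ (subst (AllPairs _≢_) t≡ t!)
  l₁! = proj₁ (proj₂ (proj₂ parts))
  l₂! = proj₂ (proj₂ (proj₂ parts))
  above : ∀ l → m ∉ l → (∀ {e} → e ∈ l → e ∈ x ∷ xs) → All (m <_) l
  above l m∉ ⊆t = All.tabulate (λ {e} e∈ → ≤∧≢⇒< (fold-⊓-≤ x xs (⊆t e∈)) (λ m≡e → m∉ (subst (_∈ l) (sym m≡e) e∈)))
  m<l₁ m<l₂ : All (m <_) _
  m<l₁ = above l₁ (proj₁ parts) (subst (_ ∈_) (sym t≡) ∘ ∈-++⁺ˡ)
  m<l₂ = above l₂ (proj₁ (proj₂ parts)) (subst (_ ∈_) (sym t≡) ∘ ∈-++⁺ʳ l₁ ∘ there)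
  lengths = length-splitOn m (x ∷ xs) (Inc.fold-∈ x xs)
  l₁≤ l₂≤ : _ ≤ n
  l₁≤ = ≤-trans (m≤m+n _ _) (≤-trans (≤-reflexive (suc-injective lengths)) len≤)
  l₂≤ = ≤-trans (m≤n+m _ _) (≤-trans (≤-reflexive (suc-injective lengths)) len≤)
  inctree-split : inctree (l₁ ++ m ∷ l₂) ≡ nd (inctree l₁) m (inctree l₂)
  inctree-split = trans (inctree≡tree _) (trans (Inc.tree-split l₁ m l₂ m<l₁ m<l₂)
    (sym (cong₂ (λ a b → nd a m b) (inctree≡tree l₁) (inctree≡tree l₂))))

descents-inctree : ∀ t → AllPairs _≢_ t → descents t ≡ rightLeafFlags (Sh (inctree t))
descents-inctree t = descents-inctreeF (length t) t ≤-refl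

nth-descents : ∀ π r → suc r < length π → nth false (descents π) r ≡ (nth 0 π (suc r) <ᵇ nth 0 π r)
nth-descents (x ∷ []) zero (s≤s ())
nth-descents (x ∷ y ∷ π) zero _ = refl
nth-descents (x ∷ y ∷ π) (suc r) (s≤s r<) = nth-descents (y ∷ π) r r<

positions-unique : ∀ w → AllPairs _≢_ (positions w)
positions-unique w = go (cells w) (cells-sorted w) (λ m m′ → cells-tag-unique w m m′) 
  where
  go : ∀ zs → AllPairs _<ₗₑₓ_ zs → (∀ {a b p} → (a , p) ∈ zs → (b , p) ∈ zs → a ≡ b) → AllPairs _≢_ (map proj₂ zs)
  go [] _ _ = []
  go ((a , t) ∷ zs) (z< ∷ zs↑) tag-unique =
    All.map⁺ (All.tabulate (λ { {b , s} z∈ refl → Lex.≺-irrefl (subst (λ c → (a , t) <ₗₑₓ (c , t)) (sym (tag-unique (here refl) (there z∈))) (All.lookup z< z∈)) }))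
    ∷ go zs zs↑ (λ m m′ → tag-unique (there m) (there m′))

countLe : ℕ → List ℕ → ℕ
countLe j = count (_≤ᵇ j)

countLe-above : ∀ j y ys → j < y → All (y ≤_) ys → countLe j (y ∷ ys) ≡ 0
countLe-above j y ys j<y y≤ys rewrite <⇒≤ᵇ-false j<y = none ys y≤ys
  where
  none : ∀ zs → All (y ≤_) zs → countLe j zs ≡ 0
  none [] [] = refl
  none (z ∷ zs) (y≤z ∷ y≤zs) rewrite <⇒≤ᵇ-false (<-≤-trans j<y y≤z) = none zs y≤zs

countLe-head : ∀ x xs → countLe x (x ∷ xs) ≡ suc (countLe x xs)
countLe-head x xs = cong (λ b → ind b + countLe x xs) (≤⇒≤ᵇ′ (≤-refl {x}))

sorted-countLe-injective : ∀ {xs ys} → AllPairs _≤_ xs → AllPairs _≤_ ys →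
                           (∀ j → countLe j xs ≡ countLe j ys) → xs ≡ ys
sorted-countLe-injective [] [] _ = refl
sorted-countLe-injective [] (_∷_ {y} {ys} _ _) same with () ← trans (same y) (countLe-head y ys)
sorted-countLe-injective (_∷_ {x} {xs} _ _) [] same with () ← trans (sym (same x)) (countLe-head x xs)
sorted-countLe-injective (_∷_ {x} {xs} x≤xs xs↑) (_∷_ {y} {ys} y≤ys ys↑) same with <-cmp x y
... | tri< x<y _ _ with () ← trans (sym (countLe-head x xs)) (trans (same x) (countLe-above x y ys x<y y≤ys))
... | tri> _ _ y<x with () ← trans (sym (countLe-head y ys)) (trans (sym (same y)) (countLe-above y x xs y<x x≤xs))
... | tri≈ _ refl _ = cong (x ∷_) (sorted-countLe-injective xs↑ ys↑ (λ j → +-cancelˡ-≡ (ind (x ≤ᵇ j)) _ _ (same j)))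

content-sorted : ∀ w → AllPairs _≤_ (content w)
content-sorted w = AllPairs.map⁺ (AllPairs.map (λ { (inj₁ a<b) → <⇒≤ a<b ; (inj₂ (refl , _)) → ≤-refl }) (cells-sorted w))

content-↭ : ∀ w → content w ↭ w
content-↭ w = subst (content w ↭_) (map-proj₁-indexed 1 w) (map⁺ proj₁ (cells-↭ w))

countLe⇒content : ∀ u v → (∀ j → countLe j u ≡ countLe j v) → content u ≡ content v
countLe⇒content u v same = sorted-countLe-injective (content-sorted u) (content-sorted v)
  (λ j → trans (count-↭ _ (content-↭ u)) (trans (same j) (sym (count-↭ _ (content-↭ v)))))

range : ℕ → ℕ → List ℕ
range n zero = []
range n (suc k) = n ∷ range (suc n) k

range-sorted : ∀ n k → AllPairs _≤_ (range n k)
range-sorted n zero = []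
range-sorted n (suc k) = above n (suc n) k (n≤1+n n) ∷ range-sorted (suc n) k
  where
  above : ∀ m n k → m ≤ n → All (m ≤_) (range n k)
  above m n zero _ = []
  above m n (suc k) m≤n = m≤n ∷ above m (suc n) k (m≤n⇒m≤1+n m≤n)

map-proj₂-indexed : ∀ n x → map proj₂ (indexed n x) ≡ range n (length x)
map-proj₂-indexed n [] = refl
map-proj₂-indexed n (y ∷ x) = cong (n ∷_) (map-proj₂-indexed (suc n) x)

indexed-zip : ∀ n x → indexed n x ≡ zip x (range n (length x))
indexed-zip n [] = refl
indexed-zip n (y ∷ x) = cong ((y , n) ∷_) (indexed-zip (suc n) x)

positions-↭ : ∀ x → positions x ↭ range 1 (length x)
positions-↭ x = subst (positions x ↭_) (map-proj₂-indexed 1 x) (map⁺ proj₂ (cells-↭ x))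

zip-map-proj : ∀ (zs : List Cell) → zip (map proj₁ zs) (map proj₂ zs) ≡ zs
zip-map-proj [] = refl
zip-map-proj (z ∷ zs) = cong (z ∷_) (zip-map-proj zs)

cells-uncells : ∀ zs → AllPairs _<ₗₑₓ_ zs → map proj₂ zs ↭ range 1 (length zs) → cells (uncells zs) ≡ zs
cells-uncells zs zs↑ zs↭ = Lex.sorted-unique (cells-sorted (uncells zs)) zs↑
  (∈-resp-↭ ys↭ ∘ subst (_ ∈_) indexed-uncells ∘ ∈-cells⁻)
  (∈-cells⁺ ∘ subst (_ ∈_) (sym indexed-uncells) ∘ ∈-resp-↭ (↭-sym ys↭))
  where
  ys = ByPosition.isort zs
  ys↭ : ys ↭ zs
  ys↭ = ByPosition.isort-↭ zs
  tags : map proj₂ ys ≡ range 1 (length zs)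
  tags = sorted-countLe-injective
    (AllPairs.map⁺ (AllPairs.map (λ { (inj₁ t<s) → <⇒≤ t<s ; (inj₂ (refl , _)) → ≤-refl }) (ByPosition.isort-sorted (Lex.sorted⇒unique zs↑))))
    (range-sorted 1 (length zs))
    (λ j → trans (count-↭ _ (map⁺ proj₂ ys↭)) (count-↭ _ zs↭))
  indexed-uncells : indexed 1 (uncells zs) ≡ ys
  indexed-uncells = begin
    indexed 1 (map proj₁ ys)                             ≡⟨ indexed-zip 1 (map proj₁ ys) ⟩
    zip (map proj₁ ys) (range 1 (length (map proj₁ ys))) ≡⟨ cong (λ k → zip (map proj₁ ys) (range 1 k)) (trans (length-map proj₁ ys) (↭-length ys↭)) ⟩
    zip (map proj₁ ys) (range 1 (length zs))             ≡⟨ cong (zip (map proj₁ ys)) (sym tags) ⟩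
    zip (map proj₁ ys) (map proj₂ ys)                    ≡⟨ zip-map-proj ys ⟩
    ys                                                   ∎

descents-transfer : ∀ c π π′ → length π ≡ length π′ → descents π ≡ descents π′ → AllPairs _≢_ π′ →
                    Linked _<ₗₑₓ_ (zip c π) → Linked _<ₗₑₓ_ (zip c π′)
descents-transfer [] π π′ _ _ _ _ = []
descents-transfer (c₁ ∷ cs) π [] _ _ _ _ = []
descents-transfer (c₁ ∷ []) π (p₁′ ∷ π′) _ _ _ _ = [-]
descents-transfer (c₁ ∷ c₂ ∷ cs) π (p₁′ ∷ []) _ _ _ _ = [-]
descents-transfer (c₁ ∷ c₂ ∷ cs) (p₁ ∷ p₂ ∷ π) (p₁′ ∷ p₂′ ∷ π′) lengths same (p₁′≢ ∷ π′!) (c₁<c₂ ∷ rest) =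
  head c₁<c₂ ∷ descents-transfer (c₂ ∷ cs) (p₂ ∷ π) (p₂′ ∷ π′) (suc-injective lengths) (proj₂ (∷-injective same)) π′! rest
  where
  head : (c₁ , p₁) <ₗₑₓ (c₂ , p₂) → (c₁ , p₁′) <ₗₑₓ (c₂ , p₂′)
  head (inj₁ c₁<c₂) = inj₁ c₁<c₂
  head (inj₂ (refl , p₁<p₂)) = inj₂ (refl , ≤∧≢⇒<
    (<ᵇ-false⇒≤ (trans (sym (proj₁ (∷-injective same))) (≤⇒<ᵇ-false (<⇒≤ p₁<p₂))))
    (All.lookup p₁′≢ (here refl)))

retarget : Word → List ℕ → Word
retarget w π = uncells (zip (content w) π)

length-zip : ∀ (a b : List ℕ) → length a ≡ length b → length (zip a b) ≡ length b
length-zip [] [] _ = refl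
length-zip (x ∷ a) (y ∷ b) e = cong suc (length-zip a b (suc-injective e))

map-zip : ∀ (a b : List ℕ) → length a ≡ length b → map proj₁ (zip a b) ≡ a × map proj₂ (zip a b) ≡ b
map-zip [] [] _ = refl , refl
map-zip (x ∷ a) (y ∷ b) e with map-zip a b (suc-injective e)
... | e₁ , e₂ = cong (x ∷_) e₁ , cong (y ∷_) e₂

cells-retarget : ∀ w v → length w ≡ length v → descents (positions w) ≡ descents (positions v) →
                 cells (retarget w (positions v)) ≡ zip (content w) (positions v)
cells-retarget w v lengths same = cells-uncells _ sorted tags
  where
  fits : length (content w) ≡ length (positions v)
  fits = trans (length-content w) (trans lengths (sym (length-positions v)))
  sorted : AllPairs _<ₗₑₓ_ (zip (content w) (positions v))
  sorted = Linked⇒AllPairs <ₗₑₓ-trans (descents-transfer (content w) (positions w) (positions v)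
    (trans (length-positions w) (trans lengths (sym (length-positions v)))) same (positions-unique v)
    (AllPairs⇒Linked (subst (AllPairs _<ₗₑₓ_) (sym (zip-map-proj (cells w))) (cells-sorted w))))
  tags : map proj₂ (zip (content w) (positions v)) ↭ range 1 (length (zip (content w) (positions v)))
  tags rewrite proj₂ (map-zip (content w) (positions v) fits) | length-zip (content w) (positions v) fits
             | length-positions v = positions-↭ v

content-positions-injective : ∀ {x y} → content x ≡ content y → positions x ≡ positions y → x ≡ y
content-positions-injective {x} {y} c≡ π≡ = cells-injective (begin
  cells x                          ≡⟨ sym (zip-map-proj (cells x)) ⟩
  zip (content x) (positions x)    ≡⟨ cong₂ zip c≡ π≡ ⟩
  zip (content y) (positions y)    ≡⟨ zip-map-proj (cells y) ⟩
  cells y                          ∎)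

adjacent-transfer : ∀ i c π π′ → length π ≡ length c → length π′ ≡ length c → descents π ≡ descents π′ →
                    AdjacentInversion i c π → AdjacentInversion i c π′
adjacent-transfer i c π π′ len len′ same (r , r< , e₁ , e₂ , π<) = r , r< , e₁ , e₂ , <ᵇ⇒<′ (begin
  nth 0 π′ (suc r) <ᵇ nth 0 π′ r   ≡⟨ sym (nth-descents π′ r (subst (suc r <_) (sym len′) r<)) ⟩
  nth false (descents π′) r        ≡⟨ cong (λ d → nth false d r) (sym same) ⟩
  nth false (descents π) r         ≡⟨ nth-descents π r (subst (suc r <_) (sym len) r<) ⟩
  nth 0 π (suc r) <ᵇ nth 0 π r     ≡⟨ <⇒<ᵇ′ π< ⟩
  true                             ∎)

Edge : Word → Word → Set
Edge a b = Step a b ⊎ Step b a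

positions-path : ∀ {a b} → Star Edge a b → positions b ≡ positions a
positions-path ε = refl
positions-path {a} (_◅_ {j = c} (inj₁ (i , e)) p) = trans (positions-path p) (qf-positions i a c e)
positions-path {a} (_◅_ {j = c} (inj₂ (i , e)) p) = trans (positions-path p) (sym (qf-positions i c a e))

module Transport (u v : Word) (same-content : content u ≡ content v)
  (same-descents : descents (positions u) ≡ descents (positions v)) where

  θ : Word → Word
  θ w = retarget w (positions v)

  module _ (w : Word) (w∼u : positions w ≡ positions u) where

    length≡u : length w ≡ length u
    length≡u = trans (sym (length-positions w)) (trans (cong length w∼u) (length-positions u))

    length≡ : length w ≡ length v
    length≡ = trans length≡u (trans (sym (length-content u)) (trans (cong length same-content) (length-content v)))

    cells-θ : cells (θ w) ≡ zip (content w) (positions v)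
    cells-θ = cells-retarget w v length≡ (trans (cong descents w∼u) same-descents)

    private
      proj-θ = map-zip (content w) (positions v) (trans (length-content w) (trans length≡ (sym (length-positions v))))

    content-θ : content (θ w) ≡ content w
    content-θ = trans (cong (map proj₁) cells-θ) (proj₁ proj-θ)

    positions-θ : positions (θ w) ≡ positions v
    positions-θ = trans (cong (map proj₂) cells-θ) (proj₂ proj-θ)

    retarget-θ : retarget (θ w) (positions u) ≡ w
    retarget-θ = cells-injective (begin
      cells (retarget (θ w) (positions u))  ≡⟨ cells-retarget (θ w) u length≡′ (trans (cong descents positions-θ) (sym same-descents)) ⟩
      zip (content (θ w)) (positions u)     ≡⟨ cong₂ zip content-θ (sym w∼u) ⟩
      zip (content w) (positions w)         ≡⟨ zip-map-proj (cells w) ⟩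
      cells w                               ∎)
      where
      length≡′ = trans (sym (length-content (θ w))) (trans (cong length content-θ) (trans (length-content w) length≡u))

    blocked-θ : ∀ i → blocked i (θ w) ≡ blocked i w
    blocked-θ i = bool-ext
      (λ b → adjacent⇒blocked i w (adjacent-transfer i (content w) (positions v) (positions w) lenᵛ lenʷ
               (sym (trans (cong descents w∼u) same-descents)) (transport-adjacent (blocked⇒adjacent i (θ w) b))))
      (λ b → adjacent⇒blocked i (θ w) (transport-adjacent′ (adjacent-transfer i (content w) (positions w) (positions v) lenʷ lenᵛ
               (trans (cong descents w∼u) same-descents) (blocked⇒adjacent i w b))))
      where
      lenʷ = trans (length-positions w) (sym (length-content w))
      lenᵛ = trans (length-positions v) (sym (trans (length-content w) length≡))
      transport-adjacent : AdjacentInversion i (content (θ w)) (positions (θ w)) → AdjacentInversion i (content w) (positions v)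
      transport-adjacent = subst₂ (AdjacentInversion i) content-θ positions-θ
      transport-adjacent′ : AdjacentInversion i (content w) (positions v) → AdjacentInversion i (content (θ w)) (positions (θ w))
      transport-adjacent′ = subst₂ (AdjacentInversion i) (sym content-θ) (sym positions-θ)

  -- the raised letter is located by the content alone, which θ preserves
  θ-step : ∀ {i w w′} → positions w ≡ positions u → qf i w ≡ just w′ → qf i (θ w) ≡ just (θ w′)
  θ-step {i} {w} {w′} w∼u e = trans step-θ (cong just y≡θw′)
    where
    raisedʷ = qf-content i w w′ e
    P = proj₁ raisedʷ
    Q = proj₁ (proj₂ raisedʷ)
    contentʷ : content w ≡ P ++ i ∷ Q
    contentʷ = proj₁ (proj₂ (proj₂ raisedʷ))
    i∉Q : i ∉ Q
    i∉Q = proj₁ (proj₂ (proj₂ (proj₂ raisedʷ)))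
    contentʷ′ : content w′ ≡ P ++ suc i ∷ Q
    contentʷ′ = proj₂ (proj₂ (proj₂ (proj₂ raisedʷ)))
    w′∼u : positions w′ ≡ positions u
    w′∼u = trans (qf-positions i w w′ e) w∼u
    i∈θw : i ∈ θ w
    i∈θw = ∈-resp-↭ (content-↭ (θ w)) (subst (i ∈_) (sym (trans (content-θ w w∼u) contentʷ)) (∈-++⁺ʳ P (here refl)))
    defined = qf-defined i (θ w) (trans (blocked-θ w w∼u i) (proj₁ (qf-just⁻ i w w′ e))) i∈θw
    y : Word
    y = proj₁ defined ++ suc i ∷ proj₁ (proj₂ defined)
    step-θ : qf i (θ w) ≡ just y
    step-θ = proj₂ (proj₂ (proj₂ (proj₂ defined)))
    raisedᶿ = qf-content i (θ w) y step-θ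
    same-split = ∷-last-unique P Q (proj₁ raisedᶿ) (proj₁ (proj₂ raisedᶿ))
      (trans (sym contentʷ) (trans (sym (content-θ w w∼u)) (proj₁ (proj₂ (proj₂ raisedᶿ)))))
      i∉Q (proj₁ (proj₂ (proj₂ (proj₂ raisedᶿ))))
    content-y : content y ≡ content (θ w′)
    content-y = begin
      content y                          ≡⟨ proj₂ (proj₂ (proj₂ (proj₂ raisedᶿ))) ⟩
      proj₁ raisedᶿ ++ suc i ∷ proj₁ (proj₂ raisedᶿ) ≡⟨ sym (cong₂ (λ p q → p ++ suc i ∷ q) (proj₁ same-split) (proj₂ same-split)) ⟩
      P ++ suc i ∷ Q                     ≡⟨ sym contentʷ′ ⟩
      content w′                         ≡⟨ sym (content-θ w′ w′∼u) ⟩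
      content (θ w′)                     ∎
    y≡θw′ : y ≡ θ w′
    y≡θw′ = content-positions-injective content-y
      (trans (qf-positions i (θ w) y step-θ) (trans (positions-θ w w∼u) (sym (positions-θ w′ w′∼u))))

  θ-u : θ u ≡ v
  θ-u = content-positions-injective (trans (content-θ u refl) same-content) (positions-θ u refl)

  θ-path : ∀ {a b} → positions a ≡ positions u → Star Edge a b → Star Edge (θ a) (θ b)
  θ-path a∼u ε = ε
  θ-path {a} a∼u (_◅_ {j = c} (inj₁ (i , e)) p) = inj₁ (i , θ-step {i} {a} {c} a∼u e) ◅ θ-path (trans (qf-positions i a c e) a∼u) p
  θ-path {a} a∼u (_◅_ {j = c} (inj₂ (i , e)) p) = inj₂ (i , θ-step {i} {c} {a} c∼u e) ◅ θ-path c∼u p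
    where
    c∼u = trans (sym (qf-positions i c a e)) a∼u

inRange : ℕ → ℕ → ℕ → Bool
inRange a t x = (a ≤ᵇ x) ∧ (x <ᵇ a + t)

inRange-suc : ∀ a t x → ind (inRange a (suc t) x) ≡ ind (inRange a t x) + ind (x ≡ᵇ (a + t))
inRange-suc a t x with <-cmp x (a + t)
... | tri< x< _ _ rewrite <⇒<ᵇ′ x< | <⇒<ᵇ′ (<-trans x< (subst (a + t <_) (sym (+-suc a t)) (n<1+n (a + t)))) | ≢⇒≡ᵇ-false (<⇒≢ x<)
  with a ≤ᵇ x
...   | true = refl
...   | false = refl
inRange-suc a t x | tri≈ _ refl _
  rewrite ≤⇒<ᵇ-false {a + t} {a + t} ≤-refl | <⇒<ᵇ′ (subst (a + t <_) (sym (+-suc a t)) (n<1+n (a + t)))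
        | ≤⇒≤ᵇ′ (m≤m+n a t) | ≡ᵇ-refl (a + t) = refl
inRange-suc a t x | tri> _ _ x> rewrite ≤⇒<ᵇ-false {x} {a + t} (<⇒≤ x>) | ≤⇒<ᵇ-false {x} {a + suc t} (subst (_≤ x) (sym (+-suc a t)) x>)
                                      | ≢⇒≡ᵇ-false (λ e → <⇒≢ x> (sym e))
  with a ≤ᵇ x
...   | true = refl
...   | false = refl

count-inRange : ∀ a t w → (∀ s → s < t → a + s ∈ w) → t ≤ count (inRange a t) w
count-inRange a zero w _ = z≤n
count-inRange a (suc t) w run rewrite count-split (inRange a (suc t)) (inRange a t) (_≡ᵇ (a + t)) (inRange-suc a t) w =
  subst (_≤ count (inRange a t) w + count (_≡ᵇ (a + t)) w) (+-comm t 1)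
    (+-mono-≤ (count-inRange a t w (λ s s< → run s (m<n⇒m<1+n s<)))
              (count-pos (_≡ᵇ (a + t)) (run t (n<1+n t)) (≡ᵇ-refl (a + t))))

no-long-run : ∀ a w → ¬ (∀ s → s ≤ length w → a + s ∈ w)
no-long-run a w run = <-irrefl refl (≤-trans (count-inRange a (suc (length w)) w (λ s s< → run s (s≤s⁻¹ s<))) (count≤length _ w))

gapSearch : Word → ℕ → ℕ → ℕ
gapSearch w zero a = a
gapSearch w (suc f) a = if elemᵇ (suc a) w then gapSearch w f (suc a) else a

gapSearch-spec : ∀ w f a → a ∈ w →
  gapSearch w f a ∈ w × gapSearch w f a ≤ a + f × (suc (gapSearch w f a) ∉ w ⊎ (∀ s → s ≤ f → a + s ∈ w))
gapSearch-spec w zero a a∈ = a∈ , ≤-reflexive (sym (+-identityʳ a)) , inj₂ (λ { zero _ → subst (_∈ w) (sym (+-identityʳ a)) a∈ })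
gapSearch-spec w (suc f) a a∈ with elemᵇ (suc a) w in e
... | false = a∈ , m≤m+n a (suc f) , inj₁ (λ sa∈ → true≢false (trans (sym (∈⇒elemᵇ (suc a) w sa∈)) e))
  where
  true≢false : true ≡ false → ⊥
  true≢false ()
... | true with gapSearch-spec w f (suc a) (elemᵇ⇒∈ (suc a) w e)
...   | g∈ , g≤ , inj₁ gap = g∈ , subst (gapSearch w f (suc a) ≤_) (sym (+-suc a f)) g≤ , inj₁ gap
...   | g∈ , g≤ , inj₂ run = g∈ , subst (gapSearch w f (suc a) ≤_) (sym (+-suc a f)) g≤ ,
          inj₂ (λ { zero _ → subst (_∈ w) (sym (+-identityʳ a)) a∈ ; (suc s) (s≤s s≤) → subst (_∈ w) (sym (+-suc a s)) (run s s≤) })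

gap-above : ∀ w {a} → a ∈ w → ∃ λ i → i ∈ w × suc i ∉ w × i ≤ a + length w
gap-above w {a} a∈ with gapSearch-spec w (length w) a a∈
... | g∈ , g≤ , inj₁ gap = gapSearch w (length w) a , g∈ , gap , g≤
... | _ , _ , inj₂ run = ⊥-elim (no-long-run a w run)

unblocked-if-absent : ∀ i w → suc i ∉ w → blocked i w ≡ false
unblocked-if-absent i [] _ = refl
unblocked-if-absent i (x ∷ w) si∉ rewrite ≢⇒≡ᵇ-false {x} {suc i} (λ e → si∉ (here (sym e))) = unblocked-if-absent i w (si∉ ∘ there)

-- the termination measure for repeatedly raising letters below the ceiling C
deficit : ℕ → Word → ℕ
deficit C [] = 0
deficit C (x ∷ w) = (C ∸ x) + deficit C w

deficit-++ : ∀ C A B → deficit C (A ++ B) ≡ deficit C A + deficit C B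
deficit-++ C [] B = refl
deficit-++ C (x ∷ A) B = trans (cong ((C ∸ x) +_) (deficit-++ C A B)) (sym (+-assoc (C ∸ x) _ _))

-- climb from a letter a ≤ j to the top i of its run a, a+1, …, i in w: as i+1 does not occur, f̈ᵢ is defined
raise-step : ∀ C j w → j + length w < C → countLe j w ≢ 0 →
             ∃ λ w′ → Step w w′ × length w′ ≡ length w × suc (deficit C w′) ≡ deficit C w
raise-step C j w bound nz with count-nonzero (_≤ᵇ j) w nz
... | a , a∈ , a≤j with gap-above w a∈
... | i , i∈ , si∉ , i≤ with qf-defined i w (unblocked-if-absent i w si∉) i∈
... | A , B , refl , _ , e = A ++ suc i ∷ B , (i , e) , trans (length-++ A) (sym (length-++ A)) , (begin
  suc (deficit C (A ++ suc i ∷ B))               ≡⟨ cong suc (deficit-++ C A (suc i ∷ B)) ⟩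
  suc (deficit C A + ((C ∸ suc i) + deficit C B)) ≡⟨ sym (+-suc (deficit C A) _) ⟩
  deficit C A + suc ((C ∸ suc i) + deficit C B)  ≡⟨ cong (λ d → deficit C A + (d + deficit C B)) (sym (∸-suc i<C)) ⟩
  deficit C A + ((C ∸ i) + deficit C B)          ≡⟨ sym (deficit-++ C A (i ∷ B)) ⟩
  deficit C (A ++ i ∷ B)                         ∎)
  where
  i<C : i < C
  i<C = ≤-<-trans i≤ (≤-<-trans (+-monoˡ-≤ (length (A ++ i ∷ B)) (≤ᵇ⇒≤′ a≤j)) bound)
  ∸-suc : ∀ {n C} → n < C → C ∸ n ≡ suc (C ∸ suc n)
  ∸-suc {zero} {suc C} _ = refl
  ∸-suc {suc n} {suc C} (s≤s n<C) = ∸-suc n<C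

raise-until-none : ∀ fuel C j w → j + length w < C → deficit C w ≤ fuel → ∃ λ w′ → Star Edge w w′ × countLe j w′ ≡ 0
raise-until-none fuel C j w bound d≤ with countLe j w in e
... | zero = w , ε , e
... | suc _ with raise-step C j w bound (λ e′ → 0≢1+n (trans (sym e′) e))
raise-until-none zero C j w bound d≤ | suc _ | w′ , _ , _ , d≡ = ⊥-elim (1+n≰0 (subst (_≤ 0) (sym d≡) d≤))
  where 1+n≰0 : ∀ {n} → ¬ (suc n ≤ 0)
        1+n≰0 ()
raise-until-none (suc fuel) C j w bound d≤ | suc _ | w′ , step , len≡ , d≡
  with raise-until-none fuel C j w′ (subst (λ l → j + l < C) (sym len≡) bound) (s≤s⁻¹ (subst (_≤ suc fuel) (sym d≡) d≤))
... | w″ , path , e′ = w″ , inj₁ step ◅ path , e′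

ind-≤ᵇ-split : ∀ i j → ind (i ≤ᵇ j) ≡ ind (suc i ≤ᵇ j) + ind (i ≡ᵇ j)
ind-≤ᵇ-split i j with <-cmp i j
... | tri< i<j _ _ rewrite ≤⇒≤ᵇ′ (<⇒≤ i<j) | ≤⇒≤ᵇ′ i<j | ≢⇒≡ᵇ-false (<⇒≢ i<j) = refl
... | tri≈ _ refl _ rewrite ≤⇒≤ᵇ′ (≤-refl {i}) | <⇒≤ᵇ-false (n<1+n i) | ≡ᵇ-refl i = refl
... | tri> _ _ j<i rewrite <⇒≤ᵇ-false j<i | <⇒≤ᵇ-false (m<n⇒m<1+n j<i) | ≢⇒≡ᵇ-false (λ e → <⇒≢ j<i (sym e)) = refl

countLe-step : ∀ i j a b → qf i a ≡ just b → countLe j a ≡ countLe j b + ind (i ≡ᵇ j)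
countLe-step i j a b e with qf-just⁻ i a b e
... | _ , A , B , refl , _ , refl = begin
  countLe j (A ++ i ∷ B)                          ≡⟨ count-++ _ A (i ∷ B) ⟩
  countLe j A + (ind (i ≤ᵇ j) + countLe j B)      ≡⟨ cong (λ z → countLe j A + (z + countLe j B)) (ind-≤ᵇ-split i j) ⟩
  countLe j A + ((ind (suc i ≤ᵇ j) + δ) + countLe j B) ≡⟨ rearrange (countLe j A) (ind (suc i ≤ᵇ j)) (countLe j B) δ ⟩
  (countLe j A + (ind (suc i ≤ᵇ j) + countLe j B)) + δ ≡⟨ cong (_+ δ) (sym (count-++ _ A (suc i ∷ B))) ⟩
  countLe j (A ++ suc i ∷ B) + δ                  ∎
  where
  δ = ind (i ≡ᵇ j)
  rearrange : ∀ a b c d → a + ((b + d) + c) ≡ (a + (b + c)) + d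
  rearrange = solve-∀

σbaxt-positions : ∀ x → σbaxt x ≡ (Sh (inctree (positions x)) , Sh (dectree (positions x)))
σbaxt-positions x = cong (λ π → Sh (inctree π) , Sh (dectree π)) (invPerm-std x)

Sh-ltree : ∀ u → Sh (ltree u) ≡ Sh (inctree (positions u))
Sh-ltree u = trans (cong Sh (ltree-cells u)) (Sh-fillInorder _ _)

Sh-rtree : ∀ u → Sh (rtree u) ≡ Sh (dectree (positions u))
Sh-rtree u = trans (cong Sh (rtree-cells u)) (Sh-fillInorder _ _)

inorder-ltree : ∀ u → inorder (ltree u) ≡ content u
inorder-ltree u = trans (cong inorder (ltree-cells u))
  (inorder-fillInorder _ _ (trans (length-content u) (sym (trans (size-inctree (positions u)) (length-positions u)))))
  where
  size-inctree : ∀ l → size (Sh (inctree l)) ≡ length l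
  size-inctree l = trans (cong (size ∘ Sh) (inctree≡tree l)) (Inc.size-tree l)

≡baxt⇒∼baxt : ∀ u v → u ≡baxt v → u ∼baxt v
≡baxt⇒∼baxt u v (ltree≡ , rtree≡) = T.θ , iso , T.θ-u , σ-preserved
  where
  inc≡ : Sh (inctree (positions u)) ≡ Sh (inctree (positions v))
  inc≡ = trans (sym (Sh-ltree u)) (trans (cong Sh ltree≡) (Sh-ltree v))
  dec≡ : Sh (dectree (positions u)) ≡ Sh (dectree (positions v))
  dec≡ = trans (sym (Sh-rtree u)) (trans (cong Sh rtree≡) (Sh-rtree v))
  content≡ : content u ≡ content v
  content≡ = trans (sym (inorder-ltree u)) (trans (cong inorder ltree≡) (inorder-ltree v))
  descents≡ : descents (positions u) ≡ descents (positions v)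
  descents≡ = trans (descents-inctree _ (positions-unique u))
    (trans (cong rightLeafFlags inc≡) (sym (descents-inctree _ (positions-unique v))))
  module T = Transport u v content≡ descents≡
  module T⁻¹ = Transport v u (sym content≡) (sym descents≡)
  back : ∀ w → InComp u w → T⁻¹.θ (T.θ w) ≡ w
  back w p = T.retarget-θ w (positions-path p)
  iso : IsIso u v T.θ
  iso = record
    { into  = λ w p → subst (λ z → Star Edge z (T.θ w)) T.θ-u (T.θ-path {u} refl p)
    ; inj   = λ w w′ p p′ e → trans (sym (back w p)) (trans (cong T⁻¹.θ e) (back w′ p′))
    ; surj  = λ y p → T⁻¹.θ y , subst (λ z → Star Edge z (T⁻¹.θ y)) T⁻¹.θ-u (T⁻¹.θ-path {v} refl p) , T⁻¹.retarget-θ y (positions-path p)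
    ; edges = λ i w w′ p p′ → mk⇔ (T.θ-step {i} {w} {w′} (positions-path p))
        (λ e → subst₂ (λ a b → qf i a ≡ just b) (back w p) (back w′ p′)
                 (T⁻¹.θ-step {i} {T.θ w} {T.θ w′} (T.positions-θ w (positions-path p)) e))
    }
  σ-preserved : ∀ w → InComp u w → σbaxt (T.θ w) ≡ σbaxt w
  σ-preserved w p = begin
    σbaxt (T.θ w)                                                ≡⟨ σbaxt-positions (T.θ w) ⟩
    (Sh (inctree (positions (T.θ w))) , Sh (dectree (positions (T.θ w)))) ≡⟨ cong (λ π → Sh (inctree π) , Sh (dectree π)) (T.positions-θ w (positions-path p)) ⟩
    (Sh (inctree (positions v)) , Sh (dectree (positions v)))    ≡⟨ sym (cong₂ _,_ inc≡ dec≡) ⟩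
    (Sh (inctree (positions u)) , Sh (dectree (positions u)))    ≡⟨ cong (λ π → Sh (inctree π) , Sh (dectree π)) (sym (positions-path p)) ⟩
    (Sh (inctree (positions w)) , Sh (dectree (positions w)))    ≡⟨ sym (σbaxt-positions w) ⟩
    σbaxt w                                                      ∎

-- An isomorphism preserves labels, so along a path it removes letters ≤ j from w and θ w at the same rate
module CountInvariance (u v : Word) (θ : Word → Word) (iso : IsIso u v θ) (θ-u : θ u ≡ v) (j : ℕ) where
  open IsIso iso

  N : Word → ℕ
  N = countLe j

  private
    swap-right : ∀ a b c → (a + b) + c ≡ (a + c) + b
    swap-right = solve-∀

  difference-invariant : ∀ b a → InComp u b → Star Edge b a → N a + N (θ b) ≡ N b + N (θ a)
  difference-invariant b .b _ ε = refl
  difference-invariant b a pb (_◅_ {j = c} (inj₁ (i , e)) p) = begin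
    N a + N (θ b)                   ≡⟨ cong (N a +_) (countLe-step i j (θ b) (θ c) (Equivalence.to (edges i b c pb pc) e)) ⟩
    N a + (N (θ c) + δ)             ≡⟨ sym (+-assoc (N a) (N (θ c)) δ) ⟩
    (N a + N (θ c)) + δ             ≡⟨ cong (_+ δ) (difference-invariant c a pc p) ⟩
    (N c + N (θ a)) + δ             ≡⟨ swap-right (N c) (N (θ a)) δ ⟩
    (N c + δ) + N (θ a)             ≡⟨ cong (_+ N (θ a)) (sym (countLe-step i j b c e)) ⟩
    N b + N (θ a)                   ∎
    where
    δ = ind (i ≡ᵇ j)
    pc = pb ◅◅ (inj₁ (i , e) ◅ ε)
  difference-invariant b a pb (_◅_ {j = c} (inj₂ (i , e)) p) = +-cancelʳ-≡ δ _ _ (begin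
    (N a + N (θ b)) + δ             ≡⟨ +-assoc (N a) (N (θ b)) δ ⟩
    N a + (N (θ b) + δ)             ≡⟨ cong (N a +_) (sym (countLe-step i j (θ c) (θ b) (Equivalence.to (edges i c b pc pb) e))) ⟩
    N a + N (θ c)                   ≡⟨ difference-invariant c a pc p ⟩
    N c + N (θ a)                   ≡⟨ cong (_+ N (θ a)) (countLe-step i j c b e) ⟩
    (N b + δ) + N (θ a)             ≡⟨ swap-right (N b) δ (N (θ a)) ⟩
    (N b + N (θ a)) + δ             ∎)
    where
    δ = ind (i ≡ᵇ j)
    pc = pb ◅◅ (inj₂ (i , e) ◅ ε)

  countLe-preserved : N u ≡ N v
  countLe-preserved = ≤-antisym u≤v v≤u
    where
    toward-u = raise-until-none _ (suc (j + length u)) j u ≤-refl ≤-refl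
    z = proj₁ toward-u
    u≤v : N u ≤ N v
    u≤v = subst (N u ≤_) (begin
      N u + N (θ z)   ≡⟨ sym (difference-invariant u z ε (proj₁ (proj₂ toward-u))) ⟩
      N z + N (θ u)   ≡⟨ cong₂ _+_ (proj₂ (proj₂ toward-u)) (cong N θ-u) ⟩
      N v             ∎) (m≤m+n (N u) (N (θ z)))
    toward-v = raise-until-none _ (suc (j + length v)) j v ≤-refl ≤-refl
    preimage = surj (proj₁ toward-v) (proj₁ (proj₂ toward-v))
    x = proj₁ preimage
    v≤u : N v ≤ N u
    v≤u = subst (N v ≤_) (begin
      N x + N v       ≡⟨ cong (N x +_) (sym (cong N θ-u)) ⟩
      N x + N (θ u)   ≡⟨ difference-invariant u x ε (proj₁ (proj₂ preimage)) ⟩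
      N u + N (θ x)   ≡⟨ cong (λ y → N u + N y) (proj₂ (proj₂ preimage)) ⟩
      N u + N (proj₁ toward-v) ≡⟨ cong (N u +_) (proj₂ (proj₂ toward-v)) ⟩
      N u + 0         ≡⟨ +-identityʳ (N u) ⟩
      N u             ∎) (m≤n+m (N v) (N x))

∼baxt⇒≡baxt : ∀ u v → u ∼baxt v → u ≡baxt v
∼baxt⇒≡baxt u v (θ , iso , θ-u , σ-preserved) = ltree≡ , rtree≡
  where
  σ≡ : (Sh (inctree (positions u)) , Sh (dectree (positions u))) ≡ (Sh (inctree (positions v)) , Sh (dectree (positions v)))
  σ≡ = trans (sym (σbaxt-positions u)) (trans (sym (σ-preserved u ε)) (trans (cong σbaxt θ-u) (σbaxt-positions v)))
  content≡ : content u ≡ content v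
  content≡ = countLe⇒content u v (CountInvariance.countLe-preserved u v θ iso θ-u)
  ltree≡ : ltree u ≡ ltree v
  ltree≡ = trans (ltree-cells u) (trans (cong₂ fillInorder (cong proj₁ σ≡) content≡) (sym (ltree-cells v)))
  rtree≡ : rtree u ≡ rtree v
  rtree≡ = trans (rtree-cells u) (trans (cong₂ fillInorder (cong proj₂ σ≡) content≡) (sym (rtree-cells v)))

proposition15 : ∀ (u v : Word) → (u ∼baxt v) ⇔ (u ≡baxt v)
proposition15 u v = mk⇔ (∼baxt⇒≡baxt u v) (≡baxt⇒∼baxt u v)
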